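{- Let $\mathbf{k}$ be a commutative ring, let $\beta,\alpha\in\mathbf{k}$, let $n$ be a positive integer, and let $\mathcal{X}=\mathbf{k}[x_{i,j}\mid 1\le i<j\le n]$. Let $D\colon\mathcal{X}\to\mathcal{T}'=\mathbf{k}[t_1,\dots,t_{n-1}]$ be the $\mathbf{k}$-algebra homomorphism with $D(x_{i,j})=t_i$, and let $E\colon\mathcal{T}'\to\mathcal{T}'[[w]]$ be the $\mathbf{k}$-algebra homomorphism with $E(t_i)=-\frac{t_i+\beta+\alpha w}{1-t_iw}$. Let $A\colon\mathcal{X}\to\mathcal{Q}$ be the $\mathbf{k}$-algebra homomorphism with $A(x_{i,j})=-\frac{q_i+\beta+\alpha/q_j}{1-q_i/q_j}$, and let $B\colon\mathcal{Q}\to\mathcal{T}[[w]]$ be the continuous $\mathbf{k}$-linear map with $$B(q_1^{a_1}\cdots q_n^{a_n})=\Big(\prod_{i:\,a_i>0}t_i^{a_i}\Big)\Big(\prod_{i:\,a_i<0}w^{ -a_i}\Big)\qquad((a_1,\dots,a_n)\in\mathbb{Z}^n).$$ Then for every pathless $q\in\mathcal{X}$ we have $E(D(q))=B(A(q))$, where $\mathcal{T}'[[w]]$ is regarded as a subring of $\mathcal{T}[[w]]$.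
   Context: $\mathcal{Q}$ is the $\mathbf{k}$-algebra of Laurent series in $r_1,\dots,r_n$: formal infinite $\mathbf{k}$-linear combinations $\sum_{b\in\mathbb{Z}^n}\lambda_b r_1^{b_1}\cdots r_n^{b_n}$ such that for some $d\in\mathbb{Z}$, $\lambda_b=0$ whenever some $b_i<d$, with the usual multiplication and the product topology (each coefficient discrete). $q_i=r_ir_{i+1}\cdots r_n$; every Laurent monomial is uniquely of the form $q_1^{a_1}\cdots q_n^{a_n}$, $a\in\mathbb{Z}^n$, so elements of $\mathcal{Q}$ are (unique) infinite $\mathbf{k}$-linear combinations of these; $1/(1-q_i/q_j)=\sum_{m\ge0}(q_i/q_j)^m$ for $i<j$. $\mathcal{T}=\mathbf{k}[[t_1,\dots,t_n]]$, $\mathcal{T}[[w]]$ is formal power series in $w$ over $\mathcal{T}$ (i.e. power series in $t_1,\dots,t_n,w$) with the product topology; $B$ is applied termwise to infinite combinations (each monomial in $t,w$ receives only finitely many contributions). $B$ is in general not multiplicative. $\mathcal{T}'=\mathbf{k}[t_1,\dots,t_{n-1}]\subseteq\mathcal{T}$. A monomial in the $x_{i,j}$ is pathless if no $x_{i,j}x_{j,k}$ with $i<j<k$ divides it; a polynomial is pathless if it is a $\mathbf{k}$-linear combination of pathless monomials. -}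

module Defs where

open import Algebra.Bundles using (CommutativeRing)
open import Data.Nat as ℕ using (ℕ; zero; suc; _∸_; _≡ᵇ_)
open import Data.Nat.Properties as ℕP using ()
open import Data.Integer as ℤ using (ℤ; +_; -[1+_])
open import Data.Fin as Fin using (Fin; toℕ; fromℕ<; inject₁; fromℕ)
open import Data.Fin.Properties using (toℕ<n)
open import Data.Bool using (Bool; true; false; _∧_; if_then_else_)
open import Data.List using (List; []; _∷_; map; foldr; concatMap; upTo)
open import Data.List.Relation.Unary.All using (All)
open import Data.List.Membership.Propositional using (_∈_)
open import Data.Product using (_×_; _,_; proj₁; proj₂)
open import Data.Vec.Functional using () renaming (_∷_ to _∷ᵛ_)
open import Function using (_∘_)
open import Relation.Nullary using (does; ¬_)
open import Relation.Binary.PropositionalEquality using (_≡_)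

-- Generic finite helpers (indices are 0-based: Fin n = {0,…,n-1}
-- stands for {1,…,n})

allB : ∀ {n} → (Fin n → Bool) → Bool
allB {zero}  _ = true
allB {suc n} p = p Fin.zero ∧ allB (p ∘ Fin.suc)

sumFinℕ : ∀ {n} → (Fin n → ℕ) → ℕ
sumFinℕ {zero}  _ = 0
sumFinℕ {suc n} v = v Fin.zero ℕ.+ sumFinℕ (v ∘ Fin.suc)

sumFinℤ : ∀ {n} → (Fin n → ℤ) → ℤ
sumFinℤ {zero}  _ = + 0
sumFinℤ {suc n} v = v Fin.zero ℤ.+ sumFinℤ (v ∘ Fin.suc)

-- minimum of 0 and all entries
minVec : ∀ {n} → (Fin n → ℤ) → ℤ
minVec {zero}  _ = + 0
minVec {suc n} v = v Fin.zero ℤ.⊓ minVec (v ∘ Fin.suc)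

eqVecℤ : ∀ {n} → (Fin n → ℤ) → (Fin n → ℤ) → Bool
eqVecℤ u v = allB (λ k → does (u k ℤ.≟ v k))

eqVecℕ : ∀ {n} → (Fin n → ℕ) → (Fin n → ℕ) → Bool
eqVecℕ u v = allB (λ k → u k ≡ᵇ v k)

cartesian : ∀ {a} {A : Set a} {n} → (Fin n → List A) → List (Fin n → A)
cartesian {n = zero}  _ = (λ ()) ∷ []
cartesian {n = suc n} L =
  concatMap (λ x → map (x ∷ᵛ_) (cartesian (L ∘ Fin.suc))) (L Fin.zero)

toℕ⁺ : ℤ → ℕ
toℕ⁺ (+ k)     = k
toℕ⁺ -[1+ _ ] = 0

-- the integers lo, lo+1, …, hi (empty if hi < lo)
rangeℤ : ℤ → ℤ → List ℤ
rangeℤ lo hi = map (λ k → lo ℤ.+ + k) (upTo (toℕ⁺ ((hi ℤ.- lo) ℤ.+ + 1)))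

boxℤ : ∀ {n} → ℤ → (Fin n → ℤ) → List (Fin n → ℤ)
boxℤ lo hi = cartesian (λ k → rangeℤ lo (hi k))

boxℕ : ∀ {n} → (Fin n → ℕ) → List (Fin n → ℕ)
boxℕ e = cartesian (λ k → upTo (suc (e k)))

unitℕ : ∀ {n} → Fin n → Fin n → ℕ
unitℕ i k = if does (i Fin.≟ k) then 1 else 0

record Var (n : ℕ) : Set where
  constructor var
  field
    i   : Fin n
    j   : Fin n
    i<j : i Fin.< j

Monomial : ℕ → Set
Monomial n = List (Var n)

PathlessMono : ∀ {n} → Monomial n → Set
PathlessMono m = ∀ {u v} → u ∈ m → v ∈ m → ¬ (Var.j u ≡ Var.i v)

-- for x_{i,j} with i < j ≤ n we have i ≤ n-1, so D(x_{i,j}) = t_i ∈ 𝒯'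
lowerVar : ∀ {n'} → Var (suc n') → Fin n'
lowerVar {n'} (var i j i<j) =
  fromℕ< {toℕ i} (ℕP.≤-trans i<j (ℕ.s≤s⁻¹ (toℕ<n j)))

module Series {c ℓ} (R : CommutativeRing c ℓ) where
  open CommutativeRing R renaming (Carrier to K)

  sumR : List K → K
  sumR = foldr _+_ 0#

  Poly : ℕ → Set c
  Poly n = List (K × Monomial n)

  PathlessPoly : ∀ {n} → Poly n → Set c
  PathlessPoly q = All (λ t → PathlessMono (proj₂ t)) q

  TPoly : ℕ → Set c
  TPoly n' = List (K × List (Fin n'))

  D : ∀ {n'} → Poly (suc n') → TPoly n'
  D = map (λ t → proj₁ t , map lowerVar (proj₂ t))

  -- Power series in t_1,…,t_n, w : coefficient of t^e w^m

  PS : ℕ → Set c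
  PS n = (Fin n → ℕ) → ℕ → K

  _≈PS_ : ∀ {n} → PS n → PS n → Set ℓ
  f ≈PS g = ∀ e m → f e m ≈ g e m

  monoPS : ∀ {n} → (Fin n → ℕ) → ℕ → K → PS n
  monoPS e₀ m₀ a e m = if eqVecℕ e e₀ ∧ (m ≡ᵇ m₀) then a else 0#

  constPS : ∀ {n} → K → PS n
  constPS a = monoPS (λ _ → 0) 0 a

  tPS : ∀ {n} → Fin n → PS n
  tPS i = monoPS (unitℕ i) 0 1#

  wPS : ∀ {n} → PS n
  wPS = monoPS (λ _ → 0) 1 1#

  addPS : ∀ {n} → PS n → PS n → PS n
  addPS f g e m = f e m + g e m

  zeroPS : ∀ {n} → PS n
  zeroPS _ _ = 0#

  negPS : ∀ {n} → PS n → PS n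
  negPS f e m = - f e m

  scalePS : ∀ {n} → K → PS n → PS n
  scalePS a f e m = a * f e m

  mulPS : ∀ {n} → PS n → PS n → PS n
  mulPS f g e m =
    sumR (map (λ e' → sumR (map (λ m' → f e' m' * g (λ k → e k ∸ e' k) (m ∸ m'))
                                (upTo (suc m))))
              (boxℕ e))

  prodPS : ∀ {n} → List (PS n) → PS n
  prodPS = foldr mulPS (constPS 1#)

  -- 1/(1 - t_i w) = Σ_{k≥0} t_i^k w^k
  geomPS : ∀ {n} → Fin n → PS n
  geomPS i e m = if eqVecℕ e (λ k → m ℕ.* unitℕ i k) then 1# else 0#

  Et : ∀ {n'} → K → K → Fin n' → PS n'
  Et β α i = negPS (mulPS (addPS (addPS (tPS i) (constPS β)) (scalePS α wPS))
                          (geomPS i))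

  E : ∀ {n'} → K → K → TPoly n' → PS n'
  E β α p = foldr addPS zeroPS
              (map (λ t → scalePS (proj₁ t) (prodPS (map (Et β α) (proj₂ t)))) p)

  -- 𝒯'[[w]] ⊆ 𝒯[[w]] (power series not involving t_n)
  embed : ∀ {n'} → PS n' → PS (suc n')
  embed {n'} f e m = if e (fromℕ n') ≡ᵇ 0 then f (e ∘ inject₁) m else 0#

  -- Laurent series 𝒬 in r_1,…,r_n: coefficient function on r-exponents
  -- b ∈ ℤ^n together with a lower bound d such that the coefficient of b
  -- vanishes whenever some b_k < d.  (All series built below satisfy this
  -- support condition by construction; multiplication uses it.)

  record LS (n : ℕ) : Set c where
    constructor mkLS
    field
      bound : ℤ
      coeff : (Fin n → ℤ) → K
  open LS public

  monoLS : ∀ {n} → (Fin n → ℤ) → K → LS n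
  monoLS v a = mkLS (minVec v) (λ b → if eqVecℤ b v then a else 0#)

  zeroLS : ∀ {n} → LS n
  zeroLS = mkLS (+ 0) (λ _ → 0#)

  constLS : ∀ {n} → K → LS n
  constLS a = monoLS (λ _ → + 0) a

  addLS : ∀ {n} → LS n → LS n → LS n
  addLS f g = mkLS (bound f ℤ.⊓ bound g) (λ b → coeff f b + coeff g b)

  negLS : ∀ {n} → LS n → LS n
  negLS f = mkLS (bound f) (λ b → - coeff f b)

  scaleLS : ∀ {n} → K → LS n → LS n
  scaleLS a f = mkLS (bound f) (λ b → a * coeff f b)

  -- (fg)_c = Σ_{b} f_b g_{c-b}, where only bound f ≤ b_k ≤ c_k - bound g
  -- can contribute
  mulLS : ∀ {n} → LS n → LS n → LS n
  mulLS f g =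
    mkLS (bound f ℤ.+ bound g)
         (λ c → sumR (map (λ b → coeff f b * coeff g (λ k → c k ℤ.- b k))
                          (boxℤ (bound f) (λ k → c k ℤ.- bound g))))

  prodLS : ∀ {n} → List (LS n) → LS n
  prodLS = foldr mulLS (constLS 1#)

  -- r-exponent of q_i = r_i r_{i+1} ⋯ r_n
  qexp : ∀ {n} → Fin n → Fin n → ℤ
  qexp i k = if toℕ i ℕ.≤ᵇ toℕ k then + 1 else + 0

  qLS : ∀ {n} → Fin n → LS n
  qLS i = monoLS (qexp i) 1#

  invqLS : ∀ {n} → Fin n → LS n
  invqLS j = monoLS (λ k → ℤ.- qexp j k) 1#

  -- 1/(1 - q_i/q_j) = Σ_{m≥0} (q_i/q_j)^m  (for i < j; the exponent of
  -- q_i/q_j at r_i is 1, so m is read off as b_i)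
  geomLS : ∀ {n} → Fin n → Fin n → LS n
  geomLS i j =
    mkLS (+ 0)
         (λ b → if (+ 0 ℤ.≤ᵇ b i) ∧ eqVecℤ b (λ k → b i ℤ.* (qexp i k ℤ.- qexp j k))
                then 1# else 0#)

  Ax : ∀ {n} → K → K → Var n → LS n
  Ax β α (var i j _) =
    negLS (mulLS (addLS (addLS (qLS i) (constLS β)) (scaleLS α (invqLS j)))
                 (geomLS i j))

  A : ∀ {n} → K → K → Poly n → LS n
  A β α q = foldr addLS zeroLS
              (map (λ t → scaleLS (proj₁ t) (prodLS (map (Ax β α) (proj₂ t)))) q)

  -- r-exponent of q_1^{a_1} ⋯ q_n^{a_n}: b_k = a_1 + ⋯ + a_k
  rexp : ∀ {n} → (Fin n → ℤ) → Fin n → ℤ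
  rexp a k = sumFinℤ (λ i → if toℕ i ℕ.≤ᵇ toℕ k then a i else + 0)

  -- Coefficient of t^e w^m in B(f): sum of the q-coefficients of f over all
  -- a ∈ ℤ^n with max(a_i,0) = e_i for all i and Σ_i max(-a_i,0) = m; all
  -- such a satisfy -m ≤ a_i ≤ e_i.
  B : ∀ {n} → LS n → PS n
  B f e m =
    sumR (map (λ a → if allB (λ i → toℕ⁺ (a i) ≡ᵇ e i)
                          ∧ (sumFinℕ (λ i → toℕ⁺ (ℤ.- a i)) ≡ᵇ m)
                     then coeff f (rexp a) else 0#)
              (boxℤ (ℤ.- (+ m)) (λ i → + e i)))

module Submission where

-- A is a ring homomorphism and B is linear, so it suffices to treat a single pathless monomial
-- x_{i₁,j₁} ⋯ x_{i_r,j_r}.  Each factor A(x_{i,j}) = -(q_i + β + α/q_j) Σ_m (q_i/q_j)^m only involves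
-- monomials q^a with a_i ≥ 0, a_j ≤ 0 and all other a_k = 0, and B(A(x_{i,j})) = E(t_i) by a direct
-- computation.  On series whose q-support lies in one closed orthant of ℤⁿ the map B is multiplicative,
-- since inside an orthant the positive parts and the negative mass of exponents are additive.  As the
-- monomial is pathless, no j_s is any i_t, so all factors live in the orthant that is nonnegative at the
-- sources i_t and nonpositive elsewhere; hence B(A(x_{i₁,j₁} ⋯)) = E(t_{i₁}) ⋯ = E(D(x_{i₁,j₁} ⋯)).

open import Defs
open import Level using (0ℓ)
open import Algebra.Bundles using (CommutativeRing)
import Algebra.Properties.AbelianGroup as AbelianGroupProperties
import Algebra.Properties.CommutativeSemigroup as CommutativeSemigroupProperties
import Algebra.Properties.Ring as RingProperties
open import Data.Bool using (Bool; true; false; T; not; _∧_; if_then_else_)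
open import Data.Bool.Properties using (T?; T-∧; T-≡; not-¬; ∧-assoc)
open import Data.Empty using (⊥-elim)
open import Data.Fin as Fin using (Fin; toℕ; inject₁; fromℕ)
import Data.Fin.Properties as FinP
open import Data.Fin.Relation.Unary.Top using (view; ‵fromℕ; ‵inj₁)
open import Data.Integer as ℤ using (ℤ; +_; -[1+_]; +≤+; -≤+; -≤-)
import Data.Integer.Properties as ℤP
open import Data.Integer.Tactic.RingSolver using (solve-∀)
open import Data.List using (List; []; _∷_; map; concatMap; upTo)
open import Data.List.Membership.Propositional using (_∈_; find; lose)
open import Data.List.Membership.Propositional.Properties using (∈-concatMap⁻; ∈-map⁻; ∈-map⁺; ∈-upTo⁺; ∈-upTo⁻)
import Data.List.Membership.Setoid as SetoidMembership
import Data.List.Membership.DecSetoid as DecSetoidMembership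
open import Data.List.Relation.Unary.All as All using (All; []; _∷_)
import Data.List.Relation.Unary.All.Properties as AllP
open import Data.List.Relation.Unary.AllPairs as AllPairs using (AllPairs; []; _∷_)
import Data.List.Relation.Unary.AllPairs.Properties as AllPairsP
open import Data.List.Relation.Unary.Any as Any using (Any; here; there; any?)
import Data.List.Relation.Unary.Any.Properties as AnyP
open import Data.List.Relation.Unary.Unique.Propositional using (Unique)
import Data.List.Relation.Unary.Unique.Propositional.Properties as UniqueP
import Data.List.Relation.Unary.Unique.Setoid as SetoidUnique
open import Data.Nat as ℕ using (ℕ; zero; suc; _∸_)
import Data.Nat.Properties as ℕP
open import Data.Product using (∃; _×_; _,_; proj₁; proj₂; map₂)
open import Data.Sum using (_⊎_; inj₁; inj₂)
open import Data.Unit using (tt)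
open import Data.Vec.Functional using (init; last) renaming (_∷_ to _∷ᵛ_)
open import Data.Vec.Functional.Relation.Binary.Pointwise.Properties using (decSetoid)
open import Function using (_∘_; _⇔_; mk⇔; Equivalence)
open import Relation.Binary.Bundles using (DecSetoid; Setoid)
import Relation.Binary.PropositionalEquality as ≡
open ≡ using (_≡_; _≢_; _≗_)
import Relation.Binary.Reasoning.Setoid as SetoidReasoning
open import Relation.Nullary using (Dec; yes; no; does; ¬_; contradiction)
open import Relation.Nullary.Decidable using (_×-dec_; dec-true; dec-false)

open Equivalence using (to; from)

i+[j-i]≡j : ∀ i j → i ℤ.+ (j ℤ.- i) ≡ j
i+[j-i]≡j = solve-∀

i+j-i≡j : ∀ i j → i ℤ.+ j ℤ.- i ≡ j
i+j-i≡j = solve-∀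

i-j+j≡i : ∀ i j → i ℤ.- j ℤ.+ j ≡ i
i-j+j≡i = solve-∀

i-[i-j]≡j : ∀ i j → i ℤ.- (i ℤ.- j) ≡ j
i-[i-j]≡j = solve-∀

module Enumeration where
  open ≡ using (refl; sym; trans; cong; cong₂; subst)

  UniqueVec : ∀ {A : Set} {n} → List (Fin n → A) → Set
  UniqueVec = AllPairs (λ u v → ¬ u ≗ v)

  module _ {A : Set} where

    ∈-cartesian⁻ : ∀ {n} (L : Fin n → List A) {x} → x ∈ cartesian L → ∀ k → x k ∈ L k
    ∈-cartesian⁻ {suc n} L x∈ k with find (∈-concatMap⁻ _ {xs = L Fin.zero} x∈)
    ... | y , y∈ , x∈ys with ∈-map⁻ (y ∷ᵛ_) x∈ys
    ... | t , t∈ , refl with k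
    ...   | Fin.zero  = y∈
    ...   | Fin.suc k = ∈-cartesian⁻ (L ∘ Fin.suc) t∈ k

    ∈-cartesian⁺ : ∀ {n} (L : Fin n → List A) v → (∀ k → v k ∈ L k) → Any (v ≗_) (cartesian L)
    ∈-cartesian⁺ {zero}  L v _ = Any.here (λ ())
    ∈-cartesian⁺ {suc n} L v v∈ = AnyP.concat⁺ (AnyP.map⁺ (lose (v∈ Fin.zero) (AnyP.map⁺ tail∈)))
      where
      tail∈ : Any (λ t → v ≗ (v Fin.zero ∷ᵛ t)) (cartesian (L ∘ Fin.suc))
      tail∈ = Any.map (λ { v≗t Fin.zero → refl ; v≗t (Fin.suc k) → v≗t k })
                      (∈-cartesian⁺ (L ∘ Fin.suc) (v ∘ Fin.suc) (v∈ ∘ Fin.suc))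

    cartesian-unique : ∀ {n} (L : Fin n → List A) → (∀ k → Unique (L k)) → UniqueVec (cartesian L)
    cartesian-unique {zero}  L _ = [] ∷ []
    cartesian-unique {suc n} L u = AllPairsP.concat⁺ (AllP.map⁺ (All.tabulate (λ _ → blocks-unique)))
                                                   (AllPairsP.map⁺ (AllPairs.map blocks-disjoint (u Fin.zero)))
      where
      tails : List (Fin n → A)
      tails = cartesian (L ∘ Fin.suc)
      blocks-unique : ∀ {y} → UniqueVec (map (y ∷ᵛ_) tails)
      blocks-unique = AllPairsP.map⁺ (AllPairs.map (λ t≉t' eq → t≉t' (eq ∘ Fin.suc))
                                                  (cartesian-unique (L ∘ Fin.suc) (u ∘ Fin.suc)))
      blocks-disjoint : ∀ {y y'} → y ≢ y' →
                        All (λ v → All (λ v' → ¬ v ≗ v') (map (y' ∷ᵛ_) tails)) (map (y ∷ᵛ_) tails)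
      blocks-disjoint y≢y' = AllP.map⁺ (All.tabulate (λ _ → AllP.map⁺ (All.tabulate (λ _ eq → y≢y' (eq Fin.zero)))))

  private
    <toℕ⁺-suc⇒≤ : ∀ k d → k ℕ.< toℕ⁺ (d ℤ.+ + 1) → + k ℤ.≤ d
    <toℕ⁺-suc⇒≤ k (+ m) k<m+1 = ℤ.+≤+ (ℕP.≤-pred (subst (k ℕ.<_) (ℕP.+-comm m 1) k<m+1))
    <toℕ⁺-suc⇒≤ k ℤ.-[1+ zero ]  ()
    <toℕ⁺-suc⇒≤ k ℤ.-[1+ suc m ] ()

    ≤⇒<toℕ⁺-suc : ∀ k d → + k ℤ.≤ d → k ℕ.< toℕ⁺ (d ℤ.+ + 1)
    ≤⇒<toℕ⁺-suc k (+ m) (ℤ.+≤+ k≤m) = subst (k ℕ.<_) (ℕP.+-comm 1 m) (ℕ.s≤s k≤m)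

  ∈-rangeℤ⁻ : ∀ lo hi {x} → x ∈ rangeℤ lo hi → lo ℤ.≤ x × x ℤ.≤ hi
  ∈-rangeℤ⁻ lo hi x∈ with ∈-map⁻ _ x∈
  ... | k , k∈ , refl =
    ℤP.i≤i+j lo (+ k) ,
    subst (lo ℤ.+ + k ℤ.≤_) (i+[j-i]≡j lo hi) (ℤP.+-monoʳ-≤ lo (<toℕ⁺-suc⇒≤ k _ (∈-upTo⁻ k∈)))

  ∈-rangeℤ⁺ : ∀ lo hi {x} → lo ℤ.≤ x → x ℤ.≤ hi → x ∈ rangeℤ lo hi
  ∈-rangeℤ⁺ lo hi {x} lo≤x x≤hi =
    subst (_∈ rangeℤ lo hi) (trans (cong (λ d → lo ℤ.+ d) offset) (i+[j-i]≡j lo x))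
          (∈-map⁺ _ (∈-upTo⁺ (≤⇒<toℕ⁺-suc _ _ (subst (ℤ._≤ hi ℤ.- lo) (sym offset) (ℤP.+-monoˡ-≤ (ℤ.- lo) x≤hi)))))
    where
    offset : + ℤ.∣ x ℤ.- lo ∣ ≡ x ℤ.- lo
    offset = ℤP.0≤i⇒+∣i∣≡i (ℤP.i≤j⇒0≤j-i lo≤x)

  rangeℤ-unique : ∀ lo hi → Unique (rangeℤ lo hi)
  rangeℤ-unique lo hi = UniqueP.map⁺ (ℤP.+-injective ∘ +-cancelˡ lo _ _) (UniqueP.upTo⁺ _)
    where open AbelianGroupProperties ℤP.+-0-abelianGroup using () renaming (∙-cancelˡ to +-cancelˡ)

  module _ {n : ℕ} where

    ∈-boxℤ⁻ : ∀ lo (hi : Fin n → ℤ) {x} → x ∈ boxℤ lo hi → ∀ k → lo ℤ.≤ x k × x k ℤ.≤ hi k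
    ∈-boxℤ⁻ lo hi x∈ k = ∈-rangeℤ⁻ lo (hi k) (∈-cartesian⁻ _ x∈ k)

    ∈-boxℤ⁺ : ∀ lo (hi : Fin n → ℤ) v → (∀ k → lo ℤ.≤ v k × v k ℤ.≤ hi k) → Any (v ≗_) (boxℤ lo hi)
    ∈-boxℤ⁺ lo hi v bounds = ∈-cartesian⁺ _ v (λ k → ∈-rangeℤ⁺ lo (hi k) (proj₁ (bounds k)) (proj₂ (bounds k)))

    boxℤ-unique : ∀ lo (hi : Fin n → ℤ) → UniqueVec (boxℤ lo hi)
    boxℤ-unique lo hi = cartesian-unique _ (λ k → rangeℤ-unique lo (hi k))

    ∈-boxℕ⁻ : ∀ (e : Fin n → ℕ) {x} → x ∈ boxℕ e → ∀ k → x k ℕ.≤ e k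
    ∈-boxℕ⁻ e x∈ k = ℕP.≤-pred (∈-upTo⁻ (∈-cartesian⁻ _ x∈ k))

    ∈-boxℕ⁺ : ∀ (e : Fin n → ℕ) v → (∀ k → v k ℕ.≤ e k) → Any (v ≗_) (boxℕ e)
    ∈-boxℕ⁺ e v v≤e = ∈-cartesian⁺ _ v (λ k → ∈-upTo⁺ (ℕ.s≤s (v≤e k)))

    boxℕ-unique : ∀ (e : Fin n → ℕ) → UniqueVec (boxℕ e)
    boxℕ-unique e = cartesian-unique _ (λ k → UniqueP.upTo⁺ _)

  ∉-boxℤ : ∀ {n} lo (hi : Fin n → ℤ) v → ¬ Any (v ≗_) (boxℤ lo hi) → ∃ λ k → v k ℤ.< lo ⊎ hi k ℤ.< v k
  ∉-boxℤ {n} lo hi v v∉ with FinP.all? (λ k → (lo ℤP.≤? v k) ×-dec (v k ℤP.≤? hi k))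
  ... | yes inside = contradiction (∈-boxℤ⁺ lo hi v inside) v∉
  ... | no ¬inside with FinP.¬∀⟶∃¬ n _ (λ k → (lo ℤP.≤? v k) ×-dec (v k ℤP.≤? hi k)) ¬inside
  ...   | k , ¬bounds with lo ℤP.≤? v k
  ...     | no  lo≰vk = k , inj₁ (ℤP.≰⇒> lo≰vk)
  ...     | yes lo≤vk = k , inj₂ (ℤP.≰⇒> (λ vk≤hi → ¬bounds (lo≤vk , vk≤hi)))

  cartesian-cong : ∀ {A : Set} {n} {L L' : Fin n → List A} → L ≗ L' → cartesian L ≡ cartesian L'
  cartesian-cong {n = zero}  _    = refl
  cartesian-cong {n = suc n} L≗L' =
    cong₂ (λ H T → concatMap (λ x → map (x ∷ᵛ_) T) H) (L≗L' Fin.zero) (cartesian-cong (L≗L' ∘ Fin.suc))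

  boxℤ-cong : ∀ {n} lo {hi hi' : Fin n → ℤ} → hi ≗ hi' → boxℤ lo hi ≡ boxℤ lo hi'
  boxℤ-cong lo hi≗hi' = cartesian-cong (cong (rangeℤ lo) ∘ hi≗hi')

  boxℕ-cong : ∀ {n} {e e' : Fin n → ℕ} → e ≗ e' → boxℕ e ≡ boxℕ e'
  boxℕ-cong e≗e' = cartesian-cong (cong (upTo ∘ suc) ∘ e≗e')

open Enumeration

module BooleanTests where
  open ≡ using (refl; sym; cong₂; subst)

  T-injective : ∀ {a b : Bool} → T a ⇔ T b → a ≡ b
  T-injective {false} {false} _   = refl
  T-injective {false} {true}  a⇔b = ⊥-elim (from a⇔b tt)
  T-injective {true}  {false} a⇔b = ⊥-elim (to a⇔b tt)
  T-injective {true}  {true}  _   = refl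

  T-does : ∀ {P : Set} (d : Dec P) → T (does d) ⇔ P
  T-does (yes p) = mk⇔ (λ _ → p) (λ _ → tt)
  T-does (no ¬p) = mk⇔ (λ ()) ¬p

  T-allB : ∀ {n} (p : Fin n → Bool) → T (allB p) ⇔ (∀ k → T (p k))
  T-allB {zero}  p = mk⇔ (λ _ ()) (λ _ → tt)
  T-allB {suc n} p with p Fin.zero in p₀
  ... | true  = mk⇔ (λ t → λ { Fin.zero → subst T (sym p₀) tt ; (Fin.suc k) → to (T-allB (p ∘ Fin.suc)) t k })
                    (λ h → from (T-allB (p ∘ Fin.suc)) (h ∘ Fin.suc))
  ... | false = mk⇔ (λ ()) (λ h → subst T p₀ (h Fin.zero))

  allB-cong : ∀ {n} {p p' : Fin n → Bool} → p ≗ p' → allB p ≡ allB p'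
  allB-cong {zero}  _    = refl
  allB-cong {suc n} p≗p' = cong₂ _∧_ (p≗p' Fin.zero) (allB-cong (p≗p' ∘ Fin.suc))

  eqVecℤ-cong : ∀ {n} {u u' v v' : Fin n → ℤ} → u ≗ u' → v ≗ v' → eqVecℤ u v ≡ eqVecℤ u' v'
  eqVecℤ-cong u≗u' v≗v' = allB-cong (λ k → cong₂ (λ x y → does (x ℤ.≟ y)) (u≗u' k) (v≗v' k))

  eqVecℕ-cong : ∀ {n} {u u' v v' : Fin n → ℕ} → u ≗ u' → v ≗ v' → eqVecℕ u v ≡ eqVecℕ u' v'
  eqVecℕ-cong u≗u' v≗v' = allB-cong (λ k → cong₂ ℕ._≡ᵇ_ (u≗u' k) (v≗v' k))

  T-eqVecℤ : ∀ {n} (u v : Fin n → ℤ) → T (eqVecℤ u v) ⇔ u ≗ v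
  T-eqVecℤ u v = mk⇔ (λ t k → to (T-does (u k ℤ.≟ v k)) (to (T-allB _) t k))
                     (λ u≗v → from (T-allB _) (λ k → from (T-does (u k ℤ.≟ v k)) (u≗v k)))

  T-eqVecℕ : ∀ {n} (u v : Fin n → ℕ) → T (eqVecℕ u v) ⇔ u ≗ v
  T-eqVecℕ u v = mk⇔ (λ t k → ℕP.≡ᵇ⇒≡ _ _ (to (T-allB _) t k))
                     (λ u≗v → from (T-allB _) (λ k → ℕP.≡⇒≡ᵇ _ _ (u≗v k)))

open BooleanTests

module Exponents where
  open ≡ using (refl; sym; trans; cong; cong₂; module ≡-Reasoning)

  -- Series.qexp and Series.rexp do not depend on the ring; these are verbatim copies.
  qexp : ∀ {n} → Fin n → Fin n → ℤ
  qexp i k = if toℕ i ℕ.≤ᵇ toℕ k then + 1 else + 0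

  rexp : ∀ {n} → (Fin n → ℤ) → Fin n → ℤ
  rexp a k = sumFinℤ (λ i → if toℕ i ℕ.≤ᵇ toℕ k then a i else + 0)

  infixl 6 _⊕_ _⊖_

  _⊕_ : ∀ {n} → (Fin n → ℤ) → (Fin n → ℤ) → Fin n → ℤ
  (a ⊕ b) k = a k ℤ.+ b k

  _⊖_ : ∀ {n} → (Fin n → ℤ) → (Fin n → ℤ) → Fin n → ℤ
  (a ⊖ b) k = a k ℤ.- b k

  sumFinℤ-cong : ∀ {n} {u v : Fin n → ℤ} → u ≗ v → sumFinℤ u ≡ sumFinℤ v
  sumFinℤ-cong {zero}  _   = refl
  sumFinℤ-cong {suc n} u≗v = cong₂ ℤ._+_ (u≗v Fin.zero) (sumFinℤ-cong (u≗v ∘ Fin.suc))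

  sumFinℤ-zero : ∀ n → sumFinℤ {n} (λ _ → + 0) ≡ + 0
  sumFinℤ-zero zero    = refl
  sumFinℤ-zero (suc n) = trans (ℤP.+-identityˡ _) (sumFinℤ-zero n)

  rexp-cong : ∀ {n} {a a' : Fin n → ℤ} → a ≗ a' → rexp a ≗ rexp a'
  rexp-cong a≗a' k = sumFinℤ-cong (λ i → cong (λ z → if toℕ i ℕ.≤ᵇ toℕ k then z else + 0) (a≗a' i))

  rexp-head : ∀ {n} (a : Fin (suc n) → ℤ) → rexp a Fin.zero ≡ a Fin.zero
  rexp-head {n} a = trans (cong (λ z → a Fin.zero ℤ.+ z) (sumFinℤ-zero n)) (ℤP.+-identityʳ _)

  rexp-tail : ∀ {n} (a : Fin (suc n) → ℤ) k → rexp a (Fin.suc k) ≡ a Fin.zero ℤ.+ rexp (a ∘ Fin.suc) k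
  rexp-tail a k = cong (λ z → a Fin.zero ℤ.+ z)
    (sumFinℤ-cong (λ i → cong (λ b → if b then a (Fin.suc i) else + 0) (<ᵇ-suc (toℕ i) (toℕ k))))
    where
    <ᵇ-suc : ∀ m n → (m ℕ.<ᵇ suc n) ≡ (m ℕ.≤ᵇ n)
    <ᵇ-suc zero    n = refl
    <ᵇ-suc (suc m) n = refl

  rexp⁻¹ : ∀ {n} → (Fin n → ℤ) → Fin n → ℤ
  rexp⁻¹ {zero}  b = b
  rexp⁻¹ {suc n} b = b Fin.zero ∷ᵛ rexp⁻¹ (λ k → b (Fin.suc k) ℤ.- b Fin.zero)

  rexp⁻¹-cong : ∀ {n} {b b' : Fin n → ℤ} → b ≗ b' → rexp⁻¹ b ≗ rexp⁻¹ b'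
  rexp⁻¹-cong {suc n} b≗b' Fin.zero    = b≗b' Fin.zero
  rexp⁻¹-cong {suc n} b≗b' (Fin.suc k) = rexp⁻¹-cong (λ i → cong₂ ℤ._-_ (b≗b' (Fin.suc i)) (b≗b' Fin.zero)) k

  rexp-rexp⁻¹ : ∀ {n} (b : Fin n → ℤ) → rexp (rexp⁻¹ b) ≗ b
  rexp-rexp⁻¹ {suc n} b Fin.zero    = rexp-head (rexp⁻¹ b)
  rexp-rexp⁻¹ {suc n} b (Fin.suc k) = begin
    rexp (rexp⁻¹ b) (Fin.suc k)                         ≡⟨ rexp-tail (rexp⁻¹ b) k ⟩
    b₀ ℤ.+ rexp (rexp⁻¹ (λ i → b (Fin.suc i) ℤ.- b₀)) k ≡⟨ cong (λ z → b₀ ℤ.+ z) (rexp-rexp⁻¹ _ k) ⟩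
    b₀ ℤ.+ (b (Fin.suc k) ℤ.- b₀)                       ≡⟨ i+[j-i]≡j b₀ (b (Fin.suc k)) ⟩
    b (Fin.suc k)                                       ∎
    where
    open ≡-Reasoning
    b₀ : ℤ
    b₀ = b Fin.zero

  rexp⁻¹-rexp : ∀ {n} (a : Fin n → ℤ) → rexp⁻¹ (rexp a) ≗ a
  rexp⁻¹-rexp {suc n} a Fin.zero    = rexp-head a
  rexp⁻¹-rexp {suc n} a (Fin.suc k) =
    trans (rexp⁻¹-cong (λ i → trans (cong₂ ℤ._-_ (rexp-tail a i) (rexp-head a)) (i+j-i≡j (a Fin.zero) _)) k)
          (rexp⁻¹-rexp (a ∘ Fin.suc) k)

  rexp-injective : ∀ {n} {a a' : Fin n → ℤ} → rexp a ≗ rexp a' → a ≗ a'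
  rexp-injective {a = a} {a'} ra≗ra' k =
    trans (sym (rexp⁻¹-rexp a k)) (trans (rexp⁻¹-cong ra≗ra' k) (rexp⁻¹-rexp a' k))

  rexp-⊖ : ∀ {n} (a b : Fin n → ℤ) → rexp (a ⊖ b) ≗ rexp a ⊖ rexp b
  rexp-⊖ {suc n} a b Fin.zero    = trans (rexp-head (a ⊖ b)) (sym (cong₂ ℤ._-_ (rexp-head a) (rexp-head b)))
  rexp-⊖ {suc n} a b (Fin.suc k) =
    trans (rexp-tail (a ⊖ b) k)
    (trans (cong (λ z → a Fin.zero ℤ.- b Fin.zero ℤ.+ z) (rexp-⊖ (a ∘ Fin.suc) (b ∘ Fin.suc) k))
    (trans (interchange (a Fin.zero) (b Fin.zero) _ _) (sym (cong₂ ℤ._-_ (rexp-tail a k) (rexp-tail b k)))))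
    where
    interchange : ∀ x y z w → x ℤ.- y ℤ.+ (z ℤ.- w) ≡ x ℤ.+ z ℤ.- (y ℤ.+ w)
    interchange = solve-∀

  infixr 7 _·_

  _·_ : ∀ {n} → ℤ → (Fin n → ℤ) → Fin n → ℤ
  (x · a) k = x ℤ.* a k

  unitℤ : ∀ {n} → Fin n → Fin n → ℤ
  unitℤ i k = + unitℕ i k

  0ᵛ : ∀ {n} → Fin n → ℤ
  0ᵛ _ = + 0

  rexp-0ᵛ : ∀ {n} → rexp (0ᵛ {n}) ≗ 0ᵛ
  rexp-0ᵛ {n} k = trans (sumFinℤ-cong {n} (λ i → if-same (toℕ i ℕ.≤ᵇ toℕ k))) (sumFinℤ-zero n)
    where
    if-same : ∀ b → (if b then + 0 else + 0) ≡ + 0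
    if-same true  = refl
    if-same false = refl

  rexp-· : ∀ {n} x (a : Fin n → ℤ) → rexp (x · a) ≗ x · rexp a
  rexp-· {suc n} x a Fin.zero    = trans (rexp-head (x · a)) (cong (x ℤ.*_) (sym (rexp-head a)))
  rexp-· {suc n} x a (Fin.suc k) =
    trans (rexp-tail (x · a) k)
    (trans (cong (λ z → x ℤ.* a Fin.zero ℤ.+ z) (rexp-· x (a ∘ Fin.suc) k))
    (trans (sym (ℤP.*-distribˡ-+ x (a Fin.zero) _)) (cong (x ℤ.*_) (sym (rexp-tail a k)))))

  rexp-unitℤ : ∀ {n} (i : Fin n) → rexp (unitℤ i) ≗ qexp i
  rexp-unitℤ {suc n} Fin.zero    Fin.zero    = rexp-head {n} (unitℤ Fin.zero)
  rexp-unitℤ {suc n} (Fin.suc i) Fin.zero    = rexp-head {n} (unitℤ (Fin.suc i))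
  rexp-unitℤ {suc n} Fin.zero (Fin.suc k) =
    trans (rexp-tail (unitℤ Fin.zero) k) (cong (λ z → + 1 ℤ.+ z) (trans (rexp-cong (λ _ → refl) k) (rexp-0ᵛ k)))
  rexp-unitℤ {suc n} (Fin.suc i) (Fin.suc k) =
    trans (rexp-tail (unitℤ (Fin.suc i)) k)
    (trans (ℤP.+-identityˡ _) (trans (rexp-unitℤ i k) (cong (λ b → if b then + 1 else + 0) (le-suc (toℕ i) (toℕ k)))))
    where
    le-suc : ∀ m n → (m ℕ.≤ᵇ n) ≡ (suc m ℕ.≤ᵇ suc n)
    le-suc zero    n = refl
    le-suc (suc m) n = refl

  minVec-≤ : ∀ {n} (v : Fin n → ℤ) k → minVec v ℤ.≤ v k
  minVec-≤ v Fin.zero    = ℤP.i⊓j≤i (v Fin.zero) _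
  minVec-≤ v (Fin.suc k) = ℤP.≤-trans (ℤP.i⊓j≤j (v Fin.zero) _) (minVec-≤ (v ∘ Fin.suc) k)

open Exponents

module Matching where
  open ≡ using (refl; sym; trans; cong; cong₂; subst)

  posPart : ∀ {n} → (Fin n → ℤ) → Fin n → ℕ
  posPart a i = toℕ⁺ (a i)

  negMass : ∀ {n} → (Fin n → ℤ) → ℕ
  negMass a = sumFinℕ (λ i → toℕ⁺ (ℤ.- a i))

  -- The test in Series.B deciding whether q^a contributes to the coefficient of t^e w^m.
  matches : ∀ {n} → (Fin n → ℕ) → ℕ → (Fin n → ℤ) → Bool
  matches e m a = allB (λ i → toℕ⁺ (a i) ℕ.≡ᵇ e i) ∧ (negMass a ℕ.≡ᵇ m)

  Matches : ∀ {n} → (Fin n → ℕ) → ℕ → (Fin n → ℤ) → Set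
  Matches e m a = posPart a ≗ e × negMass a ≡ m

  T-matches : ∀ {n} (e : Fin n → ℕ) m a → T (matches e m a) ⇔ Matches e m a
  T-matches e m a = mk⇔
    (λ t → let t₁ , t₂ = to T-∧ t in (λ k → ℕP.≡ᵇ⇒≡ _ _ (to (T-allB _) t₁ k)) , ℕP.≡ᵇ⇒≡ _ _ t₂)
    (λ (pos≗e , mass≡m) → from T-∧ (from (T-allB _) (λ k → ℕP.≡⇒≡ᵇ _ _ (pos≗e k)) , ℕP.≡⇒≡ᵇ _ _ mass≡m))

  sumFinℕ-cong : ∀ {n} {u v : Fin n → ℕ} → u ≗ v → sumFinℕ u ≡ sumFinℕ v
  sumFinℕ-cong {zero}  _   = refl
  sumFinℕ-cong {suc n} u≗v = cong₂ ℕ._+_ (u≗v Fin.zero) (sumFinℕ-cong (u≗v ∘ Fin.suc))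

  matches-cong : ∀ {n} {e e' : Fin n → ℕ} {m m'} {a a' : Fin n → ℤ} →
                 e ≗ e' → m ≡ m' → a ≗ a' → matches e m a ≡ matches e' m' a'
  matches-cong e≗e' m≡m' a≗a' =
    cong₂ _∧_ (allB-cong (λ k → cong₂ ℕ._≡ᵇ_ (cong toℕ⁺ (a≗a' k)) (e≗e' k)))
              (cong₂ ℕ._≡ᵇ_ (sumFinℕ-cong (λ k → cong (toℕ⁺ ∘ ℤ.-_) (a≗a' k))) m≡m')

  sumFinℕ-≥ : ∀ {n} (u : Fin n → ℕ) k → u k ℕ.≤ sumFinℕ u
  sumFinℕ-≥ {suc n} u Fin.zero    = ℕP.m≤m+n _ _
  sumFinℕ-≥ {suc n} u (Fin.suc k) = ℕP.≤-trans (sumFinℕ-≥ (u ∘ Fin.suc) k) (ℕP.m≤n+m _ (u Fin.zero))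

  sumFinℕ-+ : ∀ {n} (u v : Fin n → ℕ) → sumFinℕ (λ k → u k ℕ.+ v k) ≡ sumFinℕ u ℕ.+ sumFinℕ v
  sumFinℕ-+ {zero}  u v = refl
  sumFinℕ-+ {suc n} u v = trans (cong (u Fin.zero ℕ.+ v Fin.zero ℕ.+_) (sumFinℕ-+ (u ∘ Fin.suc) (v ∘ Fin.suc)))
                                (interchange (u Fin.zero) (v Fin.zero) _ _)
    where open CommutativeSemigroupProperties ℕP.+-commutativeSemigroup using (interchange)

  Matches⇒inBox : ∀ {n} {e e' : Fin n → ℕ} {m m'} {a : Fin n → ℤ} →
                  Matches e' m' a → (∀ k → e' k ℕ.≤ e k) → m' ℕ.≤ m →
                  ∀ k → ℤ.- (+ m) ℤ.≤ a k × a k ℤ.≤ + e k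
  Matches⇒inBox {a = a} (pos≗e' , mass≡m') e'≤e m'≤m k =
    neg-toℕ⁺-bound (a k) _ (ℕP.≤-trans (sumFinℕ-≥ (λ i → toℕ⁺ (ℤ.- a i)) k)
                                       (ℕP.≤-trans (ℕP.≤-reflexive mass≡m') m'≤m)) ,
    ℤP.≤-trans (≤-toℕ⁺ (a k)) (+≤+ (ℕP.≤-trans (ℕP.≤-reflexive (pos≗e' k)) (e'≤e k)))
    where
    ≤-toℕ⁺ : ∀ x → x ℤ.≤ + toℕ⁺ x
    ≤-toℕ⁺ (+ _)     = ℤP.≤-refl
    ≤-toℕ⁺ -[1+ _ ] = -≤+
    neg-toℕ⁺-bound : ∀ x m → toℕ⁺ (ℤ.- x) ℕ.≤ m → ℤ.- (+ m) ℤ.≤ x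
    neg-toℕ⁺-bound (+ _)      m       _           = ℤP.neg-≤-pos
    neg-toℕ⁺-bound -[1+ _ ] (suc m) (ℕ.s≤s k≤m) = -≤- k≤m

  Sign : Bool → ℤ → Set
  Sign true  x = + 0 ℤ.≤ x
  Sign false x = x ℤ.≤ + 0

  sign? : ∀ s x → Dec (Sign s x)
  sign? true  x = + 0 ℤP.≤? x
  sign? false x = x ℤP.≤? + 0

  InOrthant : ∀ {n} → (Fin n → Bool) → (Fin n → ℤ) → Set
  InOrthant σ a = ∀ k → Sign (σ k) (a k)

  inOrthant? : ∀ {n} (σ : Fin n → Bool) a → Dec (InOrthant σ a)
  inOrthant? σ a = FinP.all? (λ k → sign? (σ k) (a k))

  InOrthant-resp : ∀ {n} (σ : Fin n → Bool) {a a'} → a ≗ a' → InOrthant σ a → InOrthant σ a'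
  InOrthant-resp σ a≗a' a∈ k = subst (Sign (σ k)) (a≗a' k) (a∈ k)

  Sign-+ : ∀ s {x y} → Sign s x → Sign s y → Sign s (x ℤ.+ y)
  Sign-+ true  = ℤP.+-mono-≤
  Sign-+ false = ℤP.+-mono-≤

  Sign-neg : ∀ s {x} → Sign s x → Sign (not s) (ℤ.- x)
  Sign-neg true  = ℤP.neg-mono-≤
  Sign-neg false = ℤP.neg-mono-≤

  InOrthant-⊕ : ∀ {n} (σ : Fin n → Bool) {a b} → InOrthant σ a → InOrthant σ b → InOrthant σ (a ⊕ b)
  InOrthant-⊕ σ a∈ b∈ k = Sign-+ (σ k) (a∈ k) (b∈ k)

  InOrthant⇒inBox : ∀ {n} (σ : Fin n → Bool) {lo} {hi : Fin n → ℤ} {a a'} →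
                    InOrthant σ a' → InOrthant σ (a ⊖ a') → lo ℤ.≤ + 0 → (∀ k → + 0 ℤ.≤ hi k) →
                    (∀ k → lo ℤ.≤ a k × a k ℤ.≤ hi k) → ∀ k → lo ℤ.≤ a' k × a' k ℤ.≤ hi k
  InOrthant⇒inBox σ {lo} a'∈ rest∈ lo≤0 0≤hi a-bounds k = between (σ k) (a'∈ k) (rest∈ k) (0≤hi k) (a-bounds k)
    where
    between : ∀ s {hi x y} → Sign s y → Sign s (x ℤ.- y) → + 0 ℤ.≤ hi →
              lo ℤ.≤ x × x ℤ.≤ hi → lo ℤ.≤ y × y ℤ.≤ hi
    between true  0≤y 0≤x-y 0≤hi (lo≤x , x≤hi) = ℤP.≤-trans lo≤0 0≤y , ℤP.≤-trans (ℤP.0≤i-j⇒j≤i 0≤x-y) x≤hi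
    between false y≤0 x-y≤0 0≤hi (lo≤x , x≤hi) = ℤP.≤-trans lo≤x (ℤP.i-j≤0⇒i≤j x-y≤0) , ℤP.≤-trans y≤0 0≤hi

  private
    toℕ⁺-nonpos : ∀ {x} → x ℤ.≤ + 0 → toℕ⁺ x ≡ 0
    toℕ⁺-nonpos {+ zero}   _         = refl
    toℕ⁺-nonpos { -[1+ _ ]} _        = refl
    toℕ⁺-nonpos {+ suc _}  (+≤+ ())

    toℕ⁺-+ : ∀ s {x y} → Sign s x → Sign s y → toℕ⁺ (x ℤ.+ y) ≡ toℕ⁺ x ℕ.+ toℕ⁺ y
    toℕ⁺-+ true  {+ _} {+ _} _ _ = refl
    toℕ⁺-+ false {x} {y} x≤0 y≤0
      rewrite toℕ⁺-nonpos x≤0 | toℕ⁺-nonpos y≤0 = toℕ⁺-nonpos (ℤP.+-mono-≤ x≤0 y≤0)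

  module _ {n} (σ : Fin n → Bool) {a b : Fin n → ℤ} (a∈ : InOrthant σ a) (b∈ : InOrthant σ b) where

    posPart-⊕ : ∀ k → posPart (a ⊕ b) k ≡ posPart a k ℕ.+ posPart b k
    posPart-⊕ k = toℕ⁺-+ (σ k) (a∈ k) (b∈ k)

    negMass-⊕ : negMass (a ⊕ b) ≡ negMass a ℕ.+ negMass b
    negMass-⊕ = trans (sumFinℕ-cong negPart-⊕) (sumFinℕ-+ (λ i → toℕ⁺ (ℤ.- a i)) (λ i → toℕ⁺ (ℤ.- b i)))
      where
      negPart-⊕ : ∀ k → toℕ⁺ (ℤ.- (a k ℤ.+ b k)) ≡ toℕ⁺ (ℤ.- a k) ℕ.+ toℕ⁺ (ℤ.- b k)
      negPart-⊕ k rewrite ℤP.neg-distrib-+ (a k) (b k) =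
        toℕ⁺-+ (not (σ k)) (Sign-neg (σ k) (a∈ k)) (Sign-neg (σ k) (b∈ k))

    Matches-⊕⁻ : ∀ {e m} → Matches e m (a ⊕ b) →
                 (∀ k → posPart a k ℕ.≤ e k) × negMass a ℕ.≤ m ×
                 Matches (λ k → e k ∸ posPart a k) (m ∸ negMass a) b
    Matches-⊕⁻ (pos≗e , mass≡m) =
      (λ k → ℕP.≤-trans (ℕP.m≤m+n _ _) (ℕP.≤-reflexive (trans (sym (posPart-⊕ k)) (pos≗e k)))) ,
      ℕP.≤-trans (ℕP.m≤m+n _ _) (ℕP.≤-reflexive (trans (sym negMass-⊕) mass≡m)) ,
      (λ k → sym (trans (cong (_∸ posPart a k) (trans (sym (pos≗e k)) (posPart-⊕ k))) (ℕP.m+n∸m≡n (posPart a k) _))) ,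
      sym (trans (cong (_∸ negMass a) (trans (sym mass≡m) negMass-⊕)) (ℕP.m+n∸m≡n (negMass a) _))

    Matches-⊕⁺ : ∀ {e m} → (∀ k → posPart a k ℕ.≤ e k) → negMass a ℕ.≤ m →
                 Matches (λ k → e k ∸ posPart a k) (m ∸ negMass a) b → Matches e m (a ⊕ b)
    Matches-⊕⁺ pos≤e mass≤m (pos≗e∸ , mass≡m∸) =
      (λ k → trans (posPart-⊕ k) (trans (cong (posPart a k ℕ.+_) (pos≗e∸ k)) (ℕP.m+[n∸m]≡n (pos≤e k)))) ,
      trans negMass-⊕ (trans (cong (negMass a ℕ.+_) mass≡m∸) (ℕP.m+[n∸m]≡n mass≤m))

  T-matches-determined : ∀ {n} {e₀ : Fin n → ℕ} {m₀} e m a → Matches e₀ m₀ a → T (matches e m a) ⇔ (e ≗ e₀ × m ≡ m₀)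
  T-matches-determined e m a (pos≗e₀ , mass≡m₀) = mk⇔
    (λ t → let pos≗e , mass≡m = to (T-matches e m a) t in
           (λ k → trans (sym (pos≗e k)) (pos≗e₀ k)) , trans (sym mass≡m) mass≡m₀)
    (λ (e≗e₀ , m≡m₀) → from (T-matches e m a) ((λ k → trans (pos≗e₀ k) (sym (e≗e₀ k))) , trans mass≡m₀ (sym m≡m₀)))

  negMass-resp : ∀ {n} {a a' : Fin n → ℤ} → a ≗ a' → negMass a ≡ negMass a'
  negMass-resp a≗a' = sumFinℕ-cong (λ k → cong (toℕ⁺ ∘ ℤ.-_) (a≗a' k))

  ℤⁿ-decSetoid : ℕ → DecSetoid 0ℓ 0ℓ
  ℤⁿ-decSetoid = decSetoid ℤP.≡-decSetoid

  ℕⁿ-decSetoid : ℕ → DecSetoid 0ℓ 0ℓ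
  ℕⁿ-decSetoid = decSetoid ℕP.≡-decSetoid

  -- The exponents of q enumerated by B for the coefficient of t^e w^m.
  qBox : ∀ {n} → (Fin n → ℕ) → ℕ → List (Fin n → ℤ)
  qBox e m = boxℤ (ℤ.- (+ m)) (λ i → + e i)

  qBox-unique : ∀ {n} (e : Fin n → ℕ) m → UniqueVec (qBox e m)
  qBox-unique e m = boxℤ-unique (ℤ.- (+ m)) (λ i → + e i)

  ∈-qBox⁺ : ∀ {n} {e e' : Fin n → ℕ} {m m'} {a} → Matches e' m' a → (∀ k → e' k ℕ.≤ e k) → m' ℕ.≤ m →
            Any (a ≗_) (qBox e m)
  ∈-qBox⁺ {e = e} {m = m} {a = a} match e'≤e m'≤m = ∈-boxℤ⁺ (ℤ.- (+ m)) (λ i → + e i) a (Matches⇒inBox match e'≤e m'≤m)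

  ∈-qBox⁺-self : ∀ {n} {e : Fin n → ℕ} {m} {a} → Matches e m a → Any (a ≗_) (qBox e m)
  ∈-qBox⁺-self match = ∈-qBox⁺ match (λ _ → ℕP.≤-refl) ℕP.≤-refl

open Matching

module MonomialExponents where
  open ≡ using (refl; sym; trans; cong; cong₂; subst; module ≡-Reasoning)

  diffExp : ∀ {n} → (Fin n → ℕ) → (Fin n → ℕ) → Fin n → ℤ
  diffExp u v k = + u k ℤ.- + v k

  Disjoint : ∀ {n} → (Fin n → ℕ) → (Fin n → ℕ) → Set
  Disjoint u v = ∀ k → u k ≡ 0 ⊎ v k ≡ 0

  sumFinℕ-zero : ∀ n → sumFinℕ {n} (λ _ → 0) ≡ 0
  sumFinℕ-zero zero    = refl
  sumFinℕ-zero (suc n) = sumFinℕ-zero n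

  Matches-diffExp : ∀ {n} {u v : Fin n → ℕ} → Disjoint u v → Matches u (sumFinℕ v) (diffExp u v)
  Matches-diffExp {u = u} {v} u⊥v = (λ k → pos (u k) (v k) (u⊥v k)) , sumFinℕ-cong (λ k → neg (u k) (v k) (u⊥v k))
    where
    pos : ∀ x y → x ≡ 0 ⊎ y ≡ 0 → toℕ⁺ (+ x ℤ.- + y) ≡ x
    pos x       .0 (inj₂ refl) = cong toℕ⁺ (ℤP.+-identityʳ (+ x))
    pos .0 zero    (inj₁ refl) = refl
    pos .0 (suc y) (inj₁ refl) = refl
    neg : ∀ x y → x ≡ 0 ⊎ y ≡ 0 → toℕ⁺ (ℤ.- (+ x ℤ.- + y)) ≡ y
    neg .0 y       (inj₁ refl) =
      trans (cong (toℕ⁺ ∘ ℤ.-_) (ℤP.+-identityˡ (ℤ.- + y))) (cong toℕ⁺ (ℤP.neg-involutive (+ y)))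
    neg zero    .0 (inj₂ refl) = refl
    neg (suc x) .0 (inj₂ refl) = refl

  InOrthant-diffExp : ∀ {n} (σ : Fin n → Bool) {u v : Fin n → ℕ} →
                      (∀ k → σ k ≡ false → u k ≡ 0) → (∀ k → σ k ≡ true → v k ≡ 0) → InOrthant σ (diffExp u v)
  InOrthant-diffExp σ {u} {v} u-vanishes v-vanishes k with σ k in σk
  ... | true  rewrite v-vanishes k σk = subst (+ 0 ℤ.≤_) (sym (ℤP.+-identityʳ (+ u k))) (+≤+ ℕ.z≤n)
  ... | false rewrite u-vanishes k σk = subst (ℤ._≤ + 0) (sym (ℤP.+-identityˡ (ℤ.- + v k))) ℤP.neg-≤-pos

  unitℕ-off : ∀ {n} (i k : Fin n) → i ≢ k → unitℕ i k ≡ 0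
  unitℕ-off i k i≢k with i Fin.≟ k
  ... | yes i≡k = contradiction i≡k i≢k
  ... | no  _   = refl

  sumFinℕ-unitℕ : ∀ {n} (j : Fin n) → sumFinℕ (unitℕ j) ≡ 1
  sumFinℕ-unitℕ {suc n} Fin.zero    = cong suc (sumFinℕ-zero n)
  sumFinℕ-unitℕ {suc n} (Fin.suc j) = sumFinℕ-unitℕ j

  sumFinℕ-* : ∀ {n} m (u : Fin n → ℕ) → sumFinℕ (λ k → m ℕ.* u k) ≡ m ℕ.* sumFinℕ u
  sumFinℕ-* {zero}  m u = sym (ℕP.*-zeroʳ m)
  sumFinℕ-* {suc n} m u = trans (cong (m ℕ.* u Fin.zero ℕ.+_) (sumFinℕ-* m (u ∘ Fin.suc)))
                                (sym (ℕP.*-distribˡ-+ m (u Fin.zero) _))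

  rexp-scaled-unit : ∀ {n} m (i : Fin n) → rexp (λ k → + (m ℕ.* unitℕ i k)) ≗ (λ k → + m ℤ.* qexp i k)
  rexp-scaled-unit m i k =
    trans (rexp-cong (λ k → ℤP.pos-* m (unitℕ i k)) k)
          (trans (rexp-· (+ m) (unitℤ i) k) (cong (+ m ℤ.*_) (rexp-unitℤ i k)))

  module _ {n : ℕ} where

    1ᵉ : Fin n → ℤ
    1ᵉ = diffExp (λ _ → 0) (λ _ → 0)

    qᵉ : Fin n → Fin n → ℤ
    qᵉ i = diffExp (unitℕ i) (λ _ → 0)

    q⁻¹ᵉ : Fin n → Fin n → ℤ
    q⁻¹ᵉ j = diffExp (λ _ → 0) (unitℕ j)

    ratioᵉ : Fin n → Fin n → ℕ → Fin n → ℤ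
    ratioᵉ i j m = diffExp (λ k → m ℕ.* unitℕ i k) (λ k → m ℕ.* unitℕ j k)

    rexp-1ᵉ : rexp 1ᵉ ≗ (λ _ → + 0)
    rexp-1ᵉ = rexp-0ᵛ

    rexp-qᵉ : ∀ i → rexp (qᵉ i) ≗ qexp i
    rexp-qᵉ i k = trans (rexp-⊖ (unitℤ i) 0ᵛ k) (trans (cong₂ ℤ._-_ (rexp-unitℤ i k) (rexp-0ᵛ k)) (ℤP.+-identityʳ _))

    rexp-q⁻¹ᵉ : ∀ j → rexp (q⁻¹ᵉ j) ≗ (λ k → ℤ.- qexp j k)
    rexp-q⁻¹ᵉ j k = trans (rexp-⊖ 0ᵛ (unitℤ j) k) (trans (cong₂ ℤ._-_ (rexp-0ᵛ k) (rexp-unitℤ j k)) (ℤP.+-identityˡ _))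

    rexp-ratioᵉ : ∀ i j m → rexp (ratioᵉ i j m) ≗ (λ k → + m ℤ.* (qexp i k ℤ.- qexp j k))
    rexp-ratioᵉ i j m k =
      trans (rexp-⊖ _ _ k)
      (trans (cong₂ ℤ._-_ (rexp-scaled-unit m i k) (rexp-scaled-unit m j k))
             (sym (*-distribˡ-- (+ m) (qexp i k) (qexp j k))))
      where
      *-distribˡ-- : ∀ x y z → x ℤ.* (y ℤ.- z) ≡ x ℤ.* y ℤ.- x ℤ.* z
      *-distribˡ-- = solve-∀

    Matches-1ᵉ : Matches (λ _ → 0) 0 1ᵉ
    Matches-1ᵉ = map₂ (λ eq → trans eq (sumFinℕ-zero n)) (Matches-diffExp {u = λ _ → 0} {λ _ → 0} (λ _ → inj₁ refl))

    Matches-qᵉ : ∀ i → Matches (unitℕ i) 0 (qᵉ i)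
    Matches-qᵉ i = map₂ (λ eq → trans eq (sumFinℕ-zero n)) (Matches-diffExp {u = unitℕ i} {λ _ → 0} (λ _ → inj₂ refl))

    Matches-q⁻¹ᵉ : ∀ j → Matches (λ _ → 0) 1 (q⁻¹ᵉ j)
    Matches-q⁻¹ᵉ j =
      map₂ (λ eq → trans eq (sumFinℕ-unitℕ j)) (Matches-diffExp {u = λ _ → 0} {unitℕ j} (λ _ → inj₁ refl))

    Matches-ratioᵉ : ∀ {i j} → i ≢ j → ∀ m → Matches (λ k → m ℕ.* unitℕ i k) m (ratioᵉ i j m)
    Matches-ratioᵉ {i} {j} i≢j m =
      map₂ (λ eq → trans eq (trans (sumFinℕ-* m (unitℕ j))
                                   (trans (cong (m ℕ.*_) (sumFinℕ-unitℕ j)) (ℕP.*-identityʳ m))))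
           (Matches-diffExp {u = λ k → m ℕ.* unitℕ i k} {λ k → m ℕ.* unitℕ j k} disjoint)
      where
      disjoint : Disjoint (λ k → m ℕ.* unitℕ i k) (λ k → m ℕ.* unitℕ j k)
      disjoint k with i Fin.≟ k
      ... | yes refl = inj₂ (trans (cong (m ℕ.*_) (unitℕ-off j i (i≢j ∘ sym))) (ℕP.*-zeroʳ m))
      ... | no  _    = inj₁ (ℕP.*-zeroʳ m)

  module _ {n} (σ : Fin n → Bool) where

    private
      off-unit : ∀ {i} b → σ i ≡ b → ∀ k → σ k ≡ not b → unitℕ i k ≡ 0
      off-unit {i} b σi≡b k σk≡¬b = unitℕ-off i k (λ { refl → not-¬ refl (trans (sym σi≡b) σk≡¬b) })

    InOrthant-1ᵉ : InOrthant σ 1ᵉ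
    InOrthant-1ᵉ = InOrthant-diffExp σ (λ _ _ → refl) (λ _ _ → refl)

    InOrthant-qᵉ : ∀ {i} → σ i ≡ true → InOrthant σ (qᵉ i)
    InOrthant-qᵉ σi = InOrthant-diffExp σ (off-unit true σi) (λ _ _ → refl)

    InOrthant-q⁻¹ᵉ : ∀ {j} → σ j ≡ false → InOrthant σ (q⁻¹ᵉ j)
    InOrthant-q⁻¹ᵉ σj = InOrthant-diffExp σ (λ _ _ → refl) (off-unit false σj)

    InOrthant-ratioᵉ : ∀ {i j} → σ i ≡ true → σ j ≡ false → ∀ m → InOrthant σ (ratioᵉ i j m)
    InOrthant-ratioᵉ σi σj m = InOrthant-diffExp σ
      (λ k σk → trans (cong (m ℕ.*_) (off-unit true σi k σk)) (ℕP.*-zeroʳ m))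
      (λ k σk → trans (cong (m ℕ.*_) (off-unit false σj k σk)) (ℕP.*-zeroʳ m))

  -- The support test in the coefficients of Series.geomLS i j.
  geomSupport : ∀ {n} → Fin n → Fin n → (Fin n → ℤ) → Bool
  geomSupport i j b = (+ 0 ℤ.≤ᵇ b i) ∧ eqVecℤ b (λ k → b i ℤ.* (qexp i k ℤ.- qexp j k))

  module _ {n} {i j : Fin n} (i<j : i Fin.< j) where

    rexp-ratioᵉ-at-i : ∀ m → rexp (ratioᵉ i j m) i ≡ + m
    rexp-ratioᵉ-at-i m = begin
      rexp (ratioᵉ i j m) i           ≡⟨ rexp-ratioᵉ i j m i ⟩
      + m ℤ.* (qexp i i ℤ.- qexp j i) ≡⟨ cong₂ (λ x y → + m ℤ.* (x ℤ.- y)) (qexp-on (ℕP.≤-refl {toℕ i})) (qexp-off i<j) ⟩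
      + m ℤ.* + 1                     ≡⟨ ℤP.*-identityʳ (+ m) ⟩
      + m                             ∎
      where
      open ≡-Reasoning
      qexp-on : ∀ {i k : Fin n} → toℕ i ℕ.≤ toℕ k → qexp i k ≡ + 1
      qexp-on i≤k rewrite to T-≡ (ℕP.≤⇒≤ᵇ i≤k) = refl
      qexp-off : ∀ {i k : Fin n} → toℕ k ℕ.< toℕ i → qexp i k ≡ + 0
      qexp-off {i} {k} k<i with toℕ i ℕ.≤ᵇ toℕ k in i≤ᵇk
      ... | false = refl
      ... | true  = contradiction (ℕP.≤ᵇ⇒≤ _ _ (subst T (sym i≤ᵇk) _)) (ℕP.<⇒≱ k<i)

    private
      nonneg⇒pos : ∀ x → T (+ 0 ℤ.≤ᵇ x) → ∃ λ m → x ≡ + m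
      nonneg⇒pos (+ m) _ = m , refl

      ray-dir : (Fin n → ℤ) → Fin n → ℤ
      ray-dir b k = b i ℤ.* (qexp i k ℤ.- qexp j k)

    T-geomSupport : ∀ b → T (geomSupport i j b) ⇔ ∃ λ m → b ≗ rexp (ratioᵉ i j m)
    T-geomSupport b = mk⇔ ⇒ ⇐
      where
      ⇒ : T (geomSupport i j b) → ∃ λ m → b ≗ rexp (ratioᵉ i j m)
      ⇒ t with to T-∧ t
      ... | 0≤bi , ray with nonneg⇒pos (b i) 0≤bi
      ...   | m , bi≡m = m , λ k → trans (to (T-eqVecℤ b (ray-dir b)) ray k)
                                         (trans (cong (λ x → x ℤ.* _) bi≡m) (sym (rexp-ratioᵉ i j m k)))
      ⇐ : (∃ λ m → b ≗ rexp (ratioᵉ i j m)) → T (geomSupport i j b)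
      ⇐ (m , b≗r) = from T-∧ (subst (λ x → T (+ 0 ℤ.≤ᵇ x)) (sym bi≡m) _ ,
                             from (T-eqVecℤ b (ray-dir b))
                                  (λ k → trans (b≗r k) (trans (rexp-ratioᵉ i j m k) (cong (λ x → x ℤ.* _) (sym bi≡m)))))
        where
        bi≡m : b i ≡ + m
        bi≡m = trans (b≗r i) (rexp-ratioᵉ-at-i m)

    private
      qexp-step : ∀ k → ∃ λ d → qexp i k ℤ.- qexp j k ≡ + d
      qexp-step k with toℕ i ℕ.≤ᵇ toℕ k in i≤ᵇk | toℕ j ℕ.≤ᵇ toℕ k in j≤ᵇk
      ... | true  | true  = 0 , refl
      ... | true  | false = 1 , refl
      ... | false | false = 0 , refl
      ... | false | true  = contradiction (ℕP.≤⇒≤ᵇ (ℕP.≤-trans (ℕP.<⇒≤ i<j) (ℕP.≤ᵇ⇒≤ _ _ (subst T (sym j≤ᵇk) _))))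
                                          (subst T i≤ᵇk)

    0≤rexp-ratioᵉ : ∀ m k → + 0 ℤ.≤ rexp (ratioᵉ i j m) k
    0≤rexp-ratioᵉ m k with qexp-step k
    ... | d , step≡d =
      subst (+ 0 ℤ.≤_) (sym (trans (rexp-ratioᵉ i j m k) (trans (cong (+ m ℤ.*_) step≡d) (sym (ℤP.pos-* m d)))))
            (+≤+ ℕ.z≤n)

  geomSupport-cong : ∀ {n} (i j : Fin n) {b b'} → b ≗ b' → geomSupport i j b ≡ geomSupport i j b'
  geomSupport-cong i j b≗b' = cong₂ _∧_ (cong (+ 0 ℤ.≤ᵇ_) (b≗b' i)) (eqVecℤ-cong b≗b' (λ k → cong (ℤ._* _) (b≗b' i)))

open MonomialExponents

module Padding where
  open ≡ using (refl; sym; trans; cong)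

  ≗-init-last : ∀ {A : Set} {n} {u v : Fin (suc n) → A} → init u ≗ init v → last u ≡ last v → u ≗ v
  ≗-init-last init≗ last≡ k with view k
  ... | ‵fromℕ          = last≡
  ... | ‵inj₁ {i = i} _ = init≗ i

  padZero : ∀ {n} → (Fin n → ℕ) → Fin (suc n) → ℕ
  padZero {zero}  x _           = 0
  padZero {suc n} x Fin.zero    = x Fin.zero
  padZero {suc n} x (Fin.suc k) = padZero (x ∘ Fin.suc) k

  init-padZero : ∀ {n} (x : Fin n → ℕ) → init (padZero x) ≗ x
  init-padZero {suc n} x Fin.zero    = refl
  init-padZero {suc n} x (Fin.suc k) = init-padZero (x ∘ Fin.suc) k

  last-padZero : ∀ {n} (x : Fin n → ℕ) → last (padZero x) ≡ 0
  last-padZero {zero}  x = refl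
  last-padZero {suc n} x = last-padZero (x ∘ Fin.suc)

  ∈-boxℕ-last : ∀ {n} {e ê : Fin (suc n) → ℕ} → last e ≡ 0 → ê ∈ boxℕ e → last ê ≡ 0
  ∈-boxℕ-last {n} {e} last≡0 ê∈ = ℕP.n≤0⇒n≡0 (ℕP.≤-trans (∈-boxℕ⁻ e ê∈ (fromℕ n)) (ℕP.≤-reflexive last≡0))

  unitℕ-inject₁ : ∀ {n} (i k : Fin n) → unitℕ (inject₁ i) (inject₁ k) ≡ unitℕ i k
  unitℕ-inject₁ i k with i Fin.≟ k | inject₁ i Fin.≟ inject₁ k
  ... | yes _   | yes _   = refl
  ... | no  _   | no  _   = refl
  ... | yes i≡k | no  i≢k = contradiction (cong inject₁ i≡k) i≢k
  ... | no  i≢k | yes i≡k = contradiction (FinP.inject₁-injective i≡k) i≢k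

  unitℕ-inject₁-last : ∀ {n} (i : Fin n) → unitℕ (inject₁ i) (fromℕ n) ≡ 0
  unitℕ-inject₁-last {n} i with inject₁ i Fin.≟ fromℕ n
  ... | yes i≡n = contradiction (sym i≡n) FinP.fromℕ≢inject₁
  ... | no  _   = refl

  -- The test of Series.embed followed by a monomial test.
  embed-test : ∀ {n} (e : Fin (suc n) → ℕ) (e₀ : Fin n → ℕ) {e₁ : Fin (suc n) → ℕ} →
               init e₁ ≗ e₀ → last e₁ ≡ 0 → ((last e ℕ.≡ᵇ 0) ∧ eqVecℕ (init e) e₀) ≡ eqVecℕ e e₁
  embed-test e e₀ {e₁} init≗ last≡0 = T-injective (mk⇔
    (λ t → let last≡ , init-t = to T-∧ t in
           from (T-eqVecℕ e e₁) (≗-init-last (λ k → trans (to (T-eqVecℕ (init e) e₀) init-t k) (sym (init≗ k)))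
                                             (trans (ℕP.≡ᵇ⇒≡ _ 0 last≡) (sym last≡0))))
    (λ t → let e≗e₁ = to (T-eqVecℕ e e₁) t in
           from T-∧ (ℕP.≡⇒≡ᵇ _ 0 (trans (e≗e₁ _) last≡0) ,
                     from (T-eqVecℕ (init e) e₀) (λ k → trans (e≗e₁ _) (init≗ k)))))

open Padding

module _ {c ℓ} (R : CommutativeRing c ℓ) where
  open CommutativeRing R renaming (Carrier to K)
  open Series R hiding (qexp; rexp)
  open RingProperties ring using (-0#≈0#; -‿+-comm)

  ∑ : {X : Set} → List X → (X → K) → K
  ∑ L h = sumR (map h L)

  module _ {X : Set} where

    ∑-cong-∈ : ∀ (L : List X) {h k : X → K} → (∀ x → x ∈ L → h x ≈ k x) → ∑ L h ≈ ∑ L k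
    ∑-cong-∈ []      p = refl
    ∑-cong-∈ (x ∷ L) p = +-cong (p x (here ≡.refl)) (∑-cong-∈ L (λ y y∈ → p y (there y∈)))

    ∑-cong : ∀ (L : List X) {h k : X → K} → (∀ x → h x ≈ k x) → ∑ L h ≈ ∑ L k
    ∑-cong L p = ∑-cong-∈ L (λ x _ → p x)

    ∑-zero : ∀ (L : List X) {h : X → K} → (∀ x → x ∈ L → h x ≈ 0#) → ∑ L h ≈ 0#
    ∑-zero []      p = refl
    ∑-zero (x ∷ L) p =
      trans (+-cong (p x (here ≡.refl)) (∑-zero L (λ y y∈ → p y (there y∈)))) (+-identityˡ 0#)

    ∑-+ : ∀ (L : List X) (h k : X → K) → ∑ L (λ x → h x + k x) ≈ ∑ L h + ∑ L k
    ∑-+ []      h k = sym (+-identityˡ 0#)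
    ∑-+ (x ∷ L) h k =
      trans (+-congˡ (∑-+ L h k)) (CommutativeSemigroupProperties.interchange +-commutativeSemigroup (h x) (k x) _ _)

    ∑-*ˡ : ∀ (L : List X) (a : K) (h : X → K) → a * ∑ L h ≈ ∑ L (λ x → a * h x)
    ∑-*ˡ []      a h = zeroʳ a
    ∑-*ˡ (x ∷ L) a h = trans (distribˡ a (h x) (∑ L h)) (+-congˡ (∑-*ˡ L a h))

    ∑-*ʳ : ∀ (L : List X) (a : K) (h : X → K) → ∑ L h * a ≈ ∑ L (λ x → h x * a)
    ∑-*ʳ []      a h = zeroˡ a
    ∑-*ʳ (x ∷ L) a h = trans (distribʳ a (h x) (∑ L h)) (+-congˡ (∑-*ʳ L a h))

    -‿∑ : ∀ (L : List X) (h : X → K) → - ∑ L h ≈ ∑ L (λ x → - h x)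
    -‿∑ []      h = -0#≈0#
    -‿∑ (x ∷ L) h = trans (sym (-‿+-comm (h x) (∑ L h))) (+-congˡ (-‿∑ L h))

  ∑-comm : ∀ {X Y : Set} (L : List X) (M : List Y) (h : X → Y → K) →
           ∑ L (λ x → ∑ M (h x)) ≈ ∑ M (λ y → ∑ L (λ x → h x y))
  ∑-comm []      M h = sym (∑-zero M (λ _ _ → refl))
  ∑-comm (x ∷ L) M h = trans (+-congˡ (∑-comm L M h)) (sym (∑-+ M (h x) _))

  ∑-*-∑ : ∀ {X Y : Set} (L : List X) (M : List Y) (h : X → K) (k : Y → K) →
          ∑ L h * ∑ M k ≈ ∑ L (λ x → ∑ M (λ y → h x * k y))
  ∑-*-∑ L M h k = trans (∑-*ʳ L (∑ M k) h) (∑-cong L (λ x → ∑-*ˡ M (h x) k))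

  [_]_ : Bool → K → K
  [ b ] x = if b then x else 0#

  []-true : ∀ {b x} → T b → [ b ] x ≈ x
  []-true {true} _ = refl

  []-false : ∀ {b x} → ¬ T b → [ b ] x ≈ 0#
  []-false {true}  ¬t = ⊥-elim (¬t tt)
  []-false {false} _  = refl

  []-zero : ∀ b {x} → x ≈ 0# → [ b ] x ≈ 0#
  []-zero true  p = p
  []-zero false p = refl

  []-vanish : ∀ b {x} → (T b → x ≈ 0#) → [ b ] x ≈ 0#
  []-vanish true  p = p tt
  []-vanish false p = refl

  []-cong : ∀ b {x y} → (T b → x ≈ y) → [ b ] x ≈ [ b ] y
  []-cong true  p = p tt
  []-cong false p = refl

  []-cong-≡ : ∀ {b b' x y} → b ≡.≡ b' → x ≈ y → [ b ] x ≈ [ b' ] y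
  []-cong-≡ {b} ≡.refl p = []-cong b (λ _ → p)

  []-∧ : ∀ b b' x → [ b ] ([ b' ] x) ≈ [ b ∧ b' ] x
  []-∧ true  b' x = refl
  []-∧ false b' x = refl

  []-+ : ∀ b x y → [ b ] (x + y) ≈ [ b ] x + [ b ] y
  []-+ true  x y = refl
  []-+ false x y = sym (+-identityˡ 0#)

  []-neg : ∀ b x → [ b ] (- x) ≈ - [ b ] x
  []-neg true  x = refl
  []-neg false x = sym -0#≈0#

  []-*ˡ : ∀ b x y → [ b ] (x * y) ≈ x * [ b ] y
  []-*ˡ true  x y = refl
  []-*ˡ false x y = sym (zeroʳ x)

  []-∑ : ∀ {X : Set} b (L : List X) (h : X → K) → [ b ] ∑ L h ≈ ∑ L (λ x → [ b ] h x)
  []-∑ true  L h = refl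
  []-∑ false L h = sym (∑-zero L (λ _ _ → refl))

  *-zeroˡ-≈ : ∀ {x y} → x ≈ 0# → x * y ≈ 0#
  *-zeroˡ-≈ {x} {y} p = trans (*-congʳ p) (zeroˡ y)

  *-zeroʳ-≈ : ∀ {x y} → y ≈ 0# → x * y ≈ 0#
  *-zeroʳ-≈ {x} {y} p = trans (*-congˡ p) (zeroʳ x)

  module _ (S : DecSetoid 0ℓ 0ℓ) where
    open DecSetoid S using (Carrier; _≟_) renaming (_≈_ to _≐_; setoid to S-setoid; sym to ≐-sym; trans to ≐-trans)
    open SetoidMembership S-setoid using () renaming (_∈_ to _∈ₛ_)
    open SetoidUnique S-setoid using () renaming (Unique to Unique≈)

    private
      ∉-transport : ∀ {x v} {L : List Carrier} → v ≐ x → All (λ y → ¬ x ≐ y) L → ¬ v ∈ₛ L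
      ∉-transport v≐x x∉L = AllP.All¬⇒¬Any (All.map (λ x≉y v≐y → x≉y (≐-trans (≐-sym v≐x) v≐y)) x∉L)

    ∑-δ-∉ : ∀ (L : List Carrier) v a → ¬ v ∈ₛ L → ∑ L (λ x → [ does (x ≟ v) ] a) ≈ 0#
    ∑-δ-∉ L v a v∉ = ∑-zero L vanish
      where
      vanish : ∀ x → x ∈ L → [ does (x ≟ v) ] a ≈ 0#
      vanish x x∈ with x ≟ v
      ... | yes x≐v = ⊥-elim (v∉ (Any.map (λ { ≡.refl → ≐-sym x≐v }) x∈))
      ... | no _    = refl

    ∑-δ-∈ : ∀ (L : List Carrier) v a → Unique≈ L → v ∈ₛ L → ∑ L (λ x → [ does (x ≟ v) ] a) ≈ a
    ∑-δ-∈ (x ∷ L) v a (x∉L ∷ _) (here v≐x) with x ≟ v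
    ... | yes _  = trans (+-congˡ (∑-δ-∉ L v a (∉-transport v≐x x∉L))) (+-identityʳ a)
    ... | no x≉v = ⊥-elim (x≉v (≐-sym v≐x))
    ∑-δ-∈ (x ∷ L) v a (x∉L ∷ uL) (there v∈L) with x ≟ v
    ... | yes x≐v = ⊥-elim (∉-transport (≐-sym x≐v) x∉L v∈L)
    ... | no _    = trans (+-identityˡ _) (∑-δ-∈ L v a uL v∈L)

  module _ (SX SY : DecSetoid 0ℓ 0ℓ) where
    open DecSetoid SX using ()
      renaming (Carrier to X; _≈_ to _≐X_; _≟_ to _≟X_; setoid to X-setoid; sym to symX; trans to transX)
    open DecSetoid SY using ()
      renaming (Carrier to Y; _≈_ to _≐Y_; _≟_ to _≟Y_; setoid to Y-setoid; sym to symY; trans to transY)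
    open DecSetoidMembership SX using () renaming (_∈_ to _∈X_; _∈?_ to _∈X?_)
    open DecSetoidMembership SY using () renaming (_∈_ to _∈Y_; _∈?_ to _∈Y?_)
    open SetoidUnique X-setoid using () renaming (Unique to UniqueX)
    open SetoidUnique Y-setoid using () renaming (Unique to UniqueY)

    -- Both sides equal the double sum ∑ₓ ∑ᵧ [y ≐ ψ x] h x = ∑ₓ ∑ᵧ [x ≐ φ y] h (φ y).
    ∑-reindex : (L : List X) (M : List Y) (h : X → K) (φ : Y → X) (ψ : X → Y) →
      UniqueX L → UniqueY M →
      (∀ x → x ∈ L → ¬ ψ x ∈Y M → h x ≈ 0#) →
      (∀ y → y ∈ M → ¬ φ y ∈X L → h (φ y) ≈ 0#) →
      (∀ x y → x ∈ L → y ∈ M → [ does (y ≟Y ψ x) ] h x ≈ [ does (x ≟X φ y) ] h (φ y)) →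
      ∑ L h ≈ ∑ M (h ∘ φ)
    ∑-reindex L M h φ ψ uL uM outside-M outside-L agree = begin
      ∑ L h
        ≈⟨ ∑-cong-∈ L expand ⟩
      ∑ L (λ x → ∑ M (λ y → [ does (y ≟Y ψ x) ] h x))
        ≈⟨ ∑-cong-∈ L (λ x x∈ → ∑-cong-∈ M (λ y y∈ → agree x y x∈ y∈)) ⟩
      ∑ L (λ x → ∑ M (λ y → [ does (x ≟X φ y) ] h (φ y)))
        ≈⟨ ∑-comm L M _ ⟩
      ∑ M (λ y → ∑ L (λ x → [ does (x ≟X φ y) ] h (φ y)))
        ≈⟨ ∑-cong-∈ M collapse ⟩
      ∑ M (h ∘ φ) ∎
      where
      open SetoidReasoning setoid
      expand : ∀ x → x ∈ L → h x ≈ ∑ M (λ y → [ does (y ≟Y ψ x) ] h x)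
      expand x x∈ with ψ x ∈Y? M
      ... | yes ψx∈ = sym (∑-δ-∈ SY M (ψ x) (h x) uM ψx∈)
      ... | no ψx∉  = trans (outside-M x x∈ ψx∉) (sym (∑-δ-∉ SY M (ψ x) (h x) ψx∉))
      collapse : ∀ y → y ∈ M → ∑ L (λ x → [ does (x ≟X φ y) ] h (φ y)) ≈ h (φ y)
      collapse y y∈ with φ y ∈X? L
      ... | yes φy∈ = ∑-δ-∈ SX L (φ y) (h (φ y)) uL φy∈
      ... | no φy∉  = trans (∑-δ-∉ SX L (φ y) _ φy∉) (sym (outside-L y y∈ φy∉))

    ∑-reindex-bijection : (L : List X) (M : List Y) (h : X → K) (φ : Y → X) (ψ : X → Y) →
      UniqueX L → UniqueY M →
      (∀ {x x'} → x ≐X x' → h x ≈ h x') →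
      (∀ {y y'} → y ≐Y y' → φ y ≐X φ y') → (∀ {x x'} → x ≐X x' → ψ x ≐Y ψ x') →
      (∀ x → φ (ψ x) ≐X x) → (∀ y → ψ (φ y) ≐Y y) →
      (∀ x → x ∈ L → ¬ ψ x ∈Y M → h x ≈ 0#) →
      (∀ y → y ∈ M → ¬ φ y ∈X L → h (φ y) ≈ 0#) →
      ∑ L h ≈ ∑ M (h ∘ φ)
    ∑-reindex-bijection L M h φ ψ uL uM h-resp φ-resp ψ-resp φψ ψφ outside-M outside-L =
      ∑-reindex L M h φ ψ uL uM outside-M outside-L agree
      where
      agree : ∀ x y → x ∈ L → y ∈ M → [ does (y ≟Y ψ x) ] h x ≈ [ does (x ≟X φ y) ] h (φ y)
      agree x y _ _ with y ≟Y ψ x | x ≟X φ y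
      ... | yes _   | yes x≐φy = h-resp x≐φy
      ... | yes y≐ψx | no x≉φy = ⊥-elim (x≉φy (transX (symX (φψ x)) (φ-resp (symY y≐ψx))))
      ... | no y≉ψx | yes x≐φy = ⊥-elim (y≉ψx (symY (transY (ψ-resp x≐φy) (ψφ y))))
      ... | no _    | no _     = refl

  module _ {n : ℕ} where

    PS-setoid : Setoid c ℓ
    PS-setoid = record
      { Carrier       = PS n
      ; _≈_           = _≈PS_
      ; isEquivalence = record
        { refl  = λ _ _ → refl
        ; sym   = λ f≈g e m → sym (f≈g e m)
        ; trans = λ f≈g g≈h e m → trans (f≈g e m) (g≈h e m)
        }
      }

    addPS-cong : ∀ {f f' g g' : PS n} → f ≈PS f' → g ≈PS g' → addPS f g ≈PS addPS f' g'
    addPS-cong f≈f' g≈g' e m = +-cong (f≈f' e m) (g≈g' e m)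

    negPS-cong : ∀ {f f' : PS n} → f ≈PS f' → negPS f ≈PS negPS f'
    negPS-cong f≈f' e m = -‿cong (f≈f' e m)

    scalePS-cong : ∀ x {f f' : PS n} → f ≈PS f' → scalePS x f ≈PS scalePS x f'
    scalePS-cong x f≈f' e m = *-congˡ (f≈f' e m)

    mulPS-cong : ∀ {f f' g g' : PS n} → f ≈PS f' → g ≈PS g' → mulPS f g ≈PS mulPS f' g'
    mulPS-cong f≈f' g≈g' e m =
      ∑-cong (boxℕ e) (λ e' → ∑-cong (upTo (suc m)) (λ m' → *-cong (f≈f' e' m') (g≈g' (λ k → e k ∸ e' k) (m ∸ m'))))

  -- q_i + β + α/q_j and t_i + β + α w: A(x_{i,j}) and E(t_i) are these times the geometric series, negated.
  numeratorLS : ∀ {n} → K → K → Fin n → Fin n → LS n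
  numeratorLS β α i j = addLS (addLS (qLS i) (constLS β)) (scaleLS α (invqLS j))

  numeratorPS : ∀ {n} → K → K → Fin n → PS n
  numeratorPS β α i = addPS (addPS (tPS i) (constPS β)) (scalePS α wPS)

  record Supported {n} (σ : Fin n → Bool) (f : LS n) : Set ℓ where
    field
      coeff-resp    : ∀ {b b'} → b ≗ b' → coeff f b ≈ coeff f b'
      coeff-below   : ∀ b k → b k ℤ.< bound f → coeff f b ≈ 0#
      coeff-outside : ∀ a → ¬ InOrthant σ a → coeff f (rexp a) ≈ 0#
  open Supported

  qCoeff : ∀ {n} → LS n → (Fin n → ℤ) → K
  qCoeff f a = coeff f (rexp a)

  qCoeff-resp : ∀ {n σ} {h : LS n} → Supported σ h → ∀ {a a'} → a ≗ a' → qCoeff h a ≈ qCoeff h a'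
  qCoeff-resp h-supp a≗a' = coeff-resp h-supp (rexp-cong a≗a')

  B-wider : ∀ {n} (f : LS n) → (∀ {b b'} → b ≗ b' → coeff f b ≈ coeff f b') →
            ∀ {e e' : Fin n → ℕ} {m m'} → (∀ k → e' k ℕ.≤ e k) → m' ℕ.≤ m →
            B f e' m' ≈ ∑ (qBox e m) (λ a → [ matches e' m' a ] qCoeff f a)
  B-wider {n} f f-resp {e} {e'} {m} {m'} e'≤e m'≤m =
    ∑-reindex-bijection (ℤⁿ-decSetoid n) (ℤⁿ-decSetoid n) (qBox e' m') (qBox e m) h (λ a → a) (λ a → a)
      (qBox-unique e' m') (qBox-unique e m) h-resp (λ p → p) (λ p → p) (λ _ _ → ≡.refl) (λ _ _ → ≡.refl)
      (λ a _ a∉ → []-false λ t → a∉ (∈-qBox⁺ (match a t) e'≤e m'≤m))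
      (λ a _ a∉ → []-false λ t → a∉ (∈-qBox⁺-self (match a t)))
    where
    h : (Fin n → ℤ) → K
    h a = [ matches e' m' a ] qCoeff f a
    h-resp : ∀ {a a'} → a ≗ a' → h a ≈ h a'
    h-resp a≗a' = []-cong-≡ (matches-cong (λ _ → ≡.refl) ≡.refl a≗a') (f-resp (rexp-cong a≗a'))
    match : ∀ a → T (matches e' m' a) → Matches e' m' a
    match a = to (T-matches e' m' a)

  module _ {n} {σ : Fin n → Bool} where

    Supported-monoLS : ∀ {v a₀ : Fin n → ℤ} x → v ≗ rexp a₀ → InOrthant σ a₀ → Supported σ (monoLS v x)
    Supported-monoLS {v} {a₀} x v≗ra₀ a₀∈ = record
      { coeff-resp    = λ b≗b' → []-cong-≡ (eqVecℤ-cong b≗b' λ _ → ≡.refl) refl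
      ; coeff-below   = λ b k bk<min → []-false λ t → ℤP.<⇒≱ bk<min (min≤ b k (to (T-eqVecℤ b v) t))
      ; coeff-outside = λ a a∉ → []-false λ t → a∉ (InOrthant-resp σ (≡.sym ∘ at-a₀ a (to (T-eqVecℤ (rexp a) v) t)) a₀∈)
      }
      where
      at-a₀ : ∀ a → rexp a ≗ v → a ≗ a₀
      at-a₀ a ra≗v = rexp-injective (λ k → ≡.trans (ra≗v k) (v≗ra₀ k))
      min≤ : ∀ b k → b ≗ v → minVec v ℤ.≤ b k
      min≤ b k b≗v = ℤP.≤-trans (minVec-≤ v k) (ℤP.≤-reflexive (≡.sym (b≗v k)))

    Supported-constLS : ∀ x → Supported σ (constLS x)
    Supported-constLS x = Supported-monoLS x (λ k → ≡.sym (rexp-1ᵉ k)) (InOrthant-1ᵉ σ)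

    Supported-addLS : ∀ {f g} → Supported σ f → Supported σ g → Supported σ (addLS f g)
    Supported-addLS f-supp g-supp = record
      { coeff-resp    = λ b≗b' → +-cong (coeff-resp f-supp b≗b') (coeff-resp g-supp b≗b')
      ; coeff-below   = λ b k bk<min → trans (+-cong (coeff-below f-supp b k (ℤP.<-≤-trans bk<min (ℤP.i⊓j≤i _ _)))
                                                     (coeff-below g-supp b k (ℤP.<-≤-trans bk<min (ℤP.i⊓j≤j _ _))))
                                             (+-identityˡ 0#)
      ; coeff-outside = λ a a∉ → trans (+-cong (coeff-outside f-supp a a∉) (coeff-outside g-supp a a∉)) (+-identityˡ 0#)
      }

    Supported-negLS : ∀ {f} → Supported σ f → Supported σ (negLS f)
    Supported-negLS f-supp = record
      { coeff-resp    = λ b≗b' → -‿cong (coeff-resp f-supp b≗b')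
      ; coeff-below   = λ b k bk< → trans (-‿cong (coeff-below f-supp b k bk<)) -0#≈0#
      ; coeff-outside = λ a a∉ → trans (-‿cong (coeff-outside f-supp a a∉)) -0#≈0#
      }

    Supported-scaleLS : ∀ x {f} → Supported σ f → Supported σ (scaleLS x f)
    Supported-scaleLS x f-supp = record
      { coeff-resp    = λ b≗b' → *-congˡ (coeff-resp f-supp b≗b')
      ; coeff-below   = λ b k bk< → *-zeroʳ-≈ (coeff-below f-supp b k bk<)
      ; coeff-outside = λ a a∉ → *-zeroʳ-≈ (coeff-outside f-supp a a∉)
      }

  module _ {n} {σ : Fin n → Bool} {f g : LS n} (f-supp : Supported σ f) (g-supp : Supported σ g) where

    product-term-in-q : ∀ a b → coeff f b * coeff g (λ k → rexp a k ℤ.- b k) ≈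
                                qCoeff f (rexp⁻¹ b) * qCoeff g (a ⊖ rexp⁻¹ b)
    product-term-in-q a b = *-cong (coeff-resp f-supp (≡.sym ∘ rexp-rexp⁻¹ b))
      (coeff-resp g-supp (λ k → ≡.sym (≡.trans (rexp-⊖ a _ k) (≡.cong (λ x → rexp a k ℤ.- x) (rexp-rexp⁻¹ b k)))))

    product-vanishes-or-inOrthant : ∀ a a' → qCoeff f a' * qCoeff g (a ⊖ a') ≈ 0# ⊎
                                             InOrthant σ a' × InOrthant σ (a ⊖ a')
    product-vanishes-or-inOrthant a a' with inOrthant? σ a' | inOrthant? σ (a ⊖ a')
    ... | no  a'∉ | _         = inj₁ (*-zeroˡ-≈ (coeff-outside f-supp a' a'∉))
    ... | yes _   | no  rest∉ = inj₁ (*-zeroʳ-≈ (coeff-outside g-supp _ rest∉))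
    ... | yes a'∈ | yes rest∈ = inj₂ (a'∈ , rest∈)

    Supported-mulLS : Supported σ (mulLS f g)
    Supported-mulLS = record
      { coeff-resp    = λ {b} {b'} b≗b' →
          ≡.subst (λ L → ∑ L (term b) ≈ ∑ (box b') (term b'))
                  (≡.sym (boxℤ-cong (bound f) (λ k → ≡.cong (ℤ._- bound g) (b≗b' k))))
                  (∑-cong (box b') (λ x → *-congˡ (coeff-resp g-supp (shift-resp b≗b' x))))
      ; coeff-below   = λ b k bk<min → ∑-zero (box b) (λ x x∈ → contradiction (in-box b k x∈) (ℤP.<⇒≱ bk<min))
      ; coeff-outside = λ a a∉ → ∑-zero (box (rexp a)) (λ b _ → trans (product-term-in-q a b) (vanish a a∉ (rexp⁻¹ b)))
      }
      where
      box : (Fin n → ℤ) → List (Fin n → ℤ)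
      box b = boxℤ (bound f) (λ k → b k ℤ.- bound g)
      term : (Fin n → ℤ) → (Fin n → ℤ) → K
      term b x = coeff f x * coeff g (λ k → b k ℤ.- x k)
      shift-resp : ∀ {b b'} → b ≗ b' → ∀ x → (λ k → b k ℤ.- x k) ≗ (λ k → b' k ℤ.- x k)
      shift-resp b≗b' x k = ≡.cong (ℤ._- x k) (b≗b' k)
      in-box : ∀ b k {x} → x ∈ box b → bound f ℤ.+ bound g ℤ.≤ b k
      in-box b k x∈ with ∈-boxℤ⁻ (bound f) (λ k → b k ℤ.- bound g) x∈ k
      ... | lo≤xk , xk≤hi =
        ℤP.≤-trans (ℤP.+-monoˡ-≤ (bound g) (ℤP.≤-trans lo≤xk xk≤hi)) (ℤP.≤-reflexive (i-j+j≡i (b k) (bound g)))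
      vanish : ∀ a → ¬ InOrthant σ a → ∀ a' → qCoeff f a' * qCoeff g (a ⊖ a') ≈ 0#
      vanish a a∉ a' with product-vanishes-or-inOrthant a a'
      ... | inj₁ term≈0          = term≈0
      ... | inj₂ (a'∈ , rest∈) =
        contradiction (InOrthant-resp σ (λ k → i+[j-i]≡j (a' k) (a k)) (InOrthant-⊕ σ a'∈ rest∈)) a∉

  module _ {n} {σ : Fin n → Bool} {i j : Fin n} (i<j : i Fin.< j) (σi : σ i ≡ true) (σj : σ j ≡ false) where

    Supported-geomLS : Supported σ (geomLS i j)
    Supported-geomLS = record
      { coeff-resp    = λ b≗b' → []-cong-≡ (geomSupport-cong i j b≗b') refl
      ; coeff-below   = λ b k bk<0 → []-false λ t → let m , b≗r = to (T-geomSupport i<j b) t in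
                          ℤP.<⇒≱ bk<0 (≡.subst (+ 0 ℤ.≤_) (≡.sym (b≗r k)) (0≤rexp-ratioᵉ i<j m k))
      ; coeff-outside = λ a a∉ → []-false λ t → let m , ra≗r = to (T-geomSupport i<j (rexp a)) t in
                          a∉ (InOrthant-resp σ (≡.sym ∘ rexp-injective ra≗r) (InOrthant-ratioᵉ σ σi σj m))
      }

  Supported-numeratorLS : ∀ {n} {σ : Fin n → Bool} β α {i j : Fin n} → σ i ≡ true → σ j ≡ false →
                          Supported σ (numeratorLS β α i j)
  Supported-numeratorLS {σ = σ} β α {i} {j} σi σj =
    Supported-addLS (Supported-addLS (Supported-monoLS 1# (≡.sym ∘ rexp-qᵉ i) (InOrthant-qᵉ σ σi))
                                     (Supported-constLS β))
                    (Supported-scaleLS α (Supported-monoLS 1# (≡.sym ∘ rexp-q⁻¹ᵉ j) (InOrthant-q⁻¹ᵉ σ σj)))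

  Supported-Ax : ∀ {n} {σ : Fin n → Bool} β α (x : Var n) → σ (Var.i x) ≡ true → σ (Var.j x) ≡ false →
                 Supported σ (Ax β α x)
  Supported-Ax β α (var i j i<j) σi σj =
    Supported-negLS (Supported-mulLS (Supported-numeratorLS β α σi σj) (Supported-geomLS i<j σi σj))

  module _ {n : ℕ} where

    B-addLS : ∀ (f g : LS n) → B (addLS f g) ≈PS addPS (B f) (B g)
    B-addLS f g e m = trans (∑-cong (qBox e m) (λ a → []-+ (matches e m a) _ _)) (∑-+ (qBox e m) _ _)

    B-negLS : ∀ (f : LS n) → B (negLS f) ≈PS negPS (B f)
    B-negLS f e m = trans (∑-cong (qBox e m) (λ a → []-neg (matches e m a) _)) (sym (-‿∑ (qBox e m) _))

    B-scaleLS : ∀ x (f : LS n) → B (scaleLS x f) ≈PS scalePS x (B f)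
    B-scaleLS x f e m = trans (∑-cong (qBox e m) (λ a → []-*ˡ (matches e m a) x _)) (sym (∑-*ˡ (qBox e m) x _))

    B-zeroLS : B (zeroLS {n}) ≈PS zeroPS
    B-zeroLS e m = ∑-zero (qBox e m) (λ a _ → []-zero (matches e m a) refl)

    B-single-exponent : ∀ (f : LS n) (a₀ : Fin n → ℤ) x e m →
      (∀ a → a ≗ a₀ → qCoeff f a ≈ x) → (∀ a → ¬ a ≗ a₀ → T (matches e m a) → qCoeff f a ≈ 0#) →
      B f e m ≈ [ matches e m a₀ ] x
    B-single-exponent f a₀ x e m at-a₀ off-a₀ = trans (∑-cong (qBox e m) δ-form) collapse
      where
      open DecSetoid (ℤⁿ-decSetoid n) using (_≟_)
      y : K
      y = [ matches e m a₀ ] x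
      δ-form′ : ∀ a (d : Dec (a ≗ a₀)) → [ matches e m a ] qCoeff f a ≈ [ does d ] y
      δ-form′ a (yes a≗a₀) = []-cong-≡ (matches-cong (λ _ → ≡.refl) ≡.refl a≗a₀) (at-a₀ a a≗a₀)
      δ-form′ a (no  a≉a₀) = []-vanish (matches e m a) (off-a₀ a a≉a₀)
      δ-form : ∀ a → [ matches e m a ] qCoeff f a ≈ [ does (a ≟ a₀) ] y
      δ-form a = δ-form′ a (a ≟ a₀)
      collapse : ∑ (qBox e m) (λ a → [ does (a ≟ a₀) ] y) ≈ y
      collapse with T? (matches e m a₀)
      ... | yes t = ∑-δ-∈ (ℤⁿ-decSetoid n) (qBox e m) a₀ y (qBox-unique e m) (∈-qBox⁺-self (to (T-matches e m a₀) t))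
      ... | no ¬t = trans (∑-zero (qBox e m) (λ a _ → []-zero (does (a ≟ a₀)) ([]-false ¬t))) (sym ([]-false ¬t))

    B-monoLS : ∀ {v a₀ : Fin n → ℤ} {e₀ m₀} x → v ≗ rexp a₀ → Matches e₀ m₀ a₀ → B (monoLS v x) ≈PS monoPS e₀ m₀ x
    B-monoLS {v} {a₀} {e₀} {m₀} x v≗ra₀ match₀ e m =
      trans (B-single-exponent (monoLS v x) a₀ x e m at-a₀ off-a₀) ([]-cong-≡ monomial-test refl)
      where
      at-a₀ : ∀ a → a ≗ a₀ → qCoeff (monoLS v x) a ≈ x
      at-a₀ a a≗a₀ = []-true (from (T-eqVecℤ (rexp a) v) (λ k → ≡.trans (rexp-cong a≗a₀ k) (≡.sym (v≗ra₀ k))))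
      off-a₀ : ∀ a → ¬ a ≗ a₀ → T (matches e m a) → qCoeff (monoLS v x) a ≈ 0#
      off-a₀ a a≉a₀ _ = []-false λ t → a≉a₀ (rexp-injective (λ k → ≡.trans (to (T-eqVecℤ (rexp a) v) t k) (v≗ra₀ k)))
      monomial-test : matches e m a₀ ≡ (eqVecℕ e e₀ ∧ (m ℕ.≡ᵇ m₀))
      monomial-test = T-injective (mk⇔
        (λ t → let e≗e₀ , m≡m₀ = to (T-matches-determined e m a₀ match₀) t in
               from T-∧ (from (T-eqVecℕ e e₀) e≗e₀ , ℕP.≡⇒≡ᵇ m m₀ m≡m₀))
        (λ t → let t₁ , t₂ = to T-∧ t in
               from (T-matches-determined e m a₀ match₀) (to (T-eqVecℕ e e₀) t₁ , ℕP.≡ᵇ⇒≡ m m₀ t₂)))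

    B-numeratorLS : ∀ β α (i j : Fin n) → B (numeratorLS β α i j) ≈PS numeratorPS β α i
    B-numeratorLS β α i j = begin
      B (addLS (addLS (qLS i) (constLS β)) (scaleLS α (invqLS j)))
        ≈⟨ B-addLS (addLS (qLS i) (constLS β)) (scaleLS α (invqLS j)) ⟩
      addPS (B (addLS (qLS i) (constLS β))) (B (scaleLS α (invqLS j)))
        ≈⟨ addPS-cong (B-addLS (qLS i) (constLS β)) (B-scaleLS α (invqLS j)) ⟩
      addPS (addPS (B (qLS i)) (B (constLS β))) (scalePS α (B (invqLS j)))
        ≈⟨ addPS-cong (addPS-cong (B-monoLS 1# (≡.sym ∘ rexp-qᵉ i) (Matches-qᵉ i))
                                  (B-monoLS β (≡.sym ∘ rexp-1ᵉ) Matches-1ᵉ))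
                      (scalePS-cong α (B-monoLS 1# (≡.sym ∘ rexp-q⁻¹ᵉ j) (Matches-q⁻¹ᵉ j))) ⟩
      addPS (addPS (tPS i) (constPS β)) (scalePS α wPS) ∎
      where open SetoidReasoning (PS-setoid {n})

  module _ {n} {i j : Fin n} (i<j : i Fin.< j) where

    B-geomLS : B (geomLS i j) ≈PS geomPS i
    B-geomLS e m = trans (B-single-exponent (geomLS i j) (ratioᵉ i j m) 1# e m at-ratio off-ratio)
                         ([]-cong-≡ geometric-test refl)
      where
      match : ∀ m → Matches (λ k → m ℕ.* unitℕ i k) m (ratioᵉ i j m)
      match = Matches-ratioᵉ (FinP.<⇒≢ i<j)
      at-ratio : ∀ a → a ≗ ratioᵉ i j m → qCoeff (geomLS i j) a ≈ 1#
      at-ratio a a≗r = []-true (from (T-geomSupport i<j (rexp a)) (m , rexp-cong a≗r))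
      off-ratio : ∀ a → ¬ a ≗ ratioᵉ i j m → T (matches e m a) → qCoeff (geomLS i j) a ≈ 0#
      off-ratio a a≉r t = []-false λ s →
        let M , ra≗r = to (T-geomSupport i<j (rexp a)) s in a≉r (on-ray M (rexp-injective ra≗r))
        where
        -- the exponent m of w is the negative mass of a, which pins down the ray point
        on-ray : ∀ M → a ≗ ratioᵉ i j M → a ≗ ratioᵉ i j m
        on-ray M a≗r = λ k → ≡.trans (a≗r k) (≡.cong (λ M → ratioᵉ i j M k) M≡m)
          where
          M≡m : M ≡ m
          M≡m = ≡.trans (≡.sym (proj₂ (match M))) (≡.trans (≡.sym (negMass-resp a≗r)) (proj₂ (to (T-matches e m a) t)))
      geometric-test : matches e m (ratioᵉ i j m) ≡ eqVecℕ e (λ k → m ℕ.* unitℕ i k)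
      geometric-test = T-injective (mk⇔
        (λ t → from (T-eqVecℕ e _) (proj₁ (to (T-matches-determined e m (ratioᵉ i j m) (match m)) t)))
        (λ t → from (T-matches-determined e m (ratioᵉ i j m) (match m)) (to (T-eqVecℕ e _) t , ≡.refl)))

  module Multiplicativity {n} {σ : Fin n → Bool} {f g : LS n} (f-supp : Supported σ f) (g-supp : Supported σ g)
                          (e : Fin n → ℕ) (m : ℕ) where
    open SetoidReasoning setoid

    U : List (Fin n → ℤ)
    U = qBox e m

    F G : (Fin n → ℤ) → K
    F = qCoeff f
    G = qCoeff g

    summand-∈U : ∀ a {a'} → T (matches e m a) → InOrthant σ a' → InOrthant σ (a ⊖ a') → Any (a' ≗_) U
    summand-∈U a {a'} t a'∈ rest∈ = ∈-boxℤ⁺ (ℤ.- (+ m)) (λ i → + e i) a'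
      (InOrthant⇒inBox σ {a = a} a'∈ rest∈ ℤP.neg-≤-pos (λ _ → ℤ.+≤+ ℕ.z≤n)
                       (Matches⇒inBox (to (T-matches e m a) t) (λ _ → ℕP.≤-refl) ℕP.≤-refl))

    summand-outside-U : ∀ a a' → T (matches e m a) → ¬ Any (a' ≗_) U → F a' * G (a ⊖ a') ≈ 0#
    summand-outside-U a a' t ∉U with product-vanishes-or-inOrthant f-supp g-supp a a'
    ... | inj₁ term≈0          = term≈0
    ... | inj₂ (a'∈ , rest∈) = contradiction (summand-∈U a t a'∈ rest∈) ∉U

    remainder-outside-U : ∀ a a' → T (matches e m a) → ¬ Any ((a ⊖ a') ≗_) U → F a' * G (a ⊖ a') ≈ 0#
    remainder-outside-U a a' t ∉U with product-vanishes-or-inOrthant f-supp g-supp a a'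
    ... | inj₁ term≈0          = term≈0
    ... | inj₂ (a'∈ , rest∈) =
      contradiction (summand-∈U a t rest∈ (InOrthant-resp σ (λ k → ≡.sym (i-[i-j]≡j (a k) (a' k))) a'∈)) ∉U

    coeff-mulLS-in-q : ∀ a → T (matches e m a) → coeff (mulLS f g) (rexp a) ≈ ∑ U (λ a' → F a' * G (a ⊖ a'))
    coeff-mulLS-in-q a t = sym (begin
      ∑ U h                       ≈⟨ ∑-reindex-bijection (ℤⁿ-decSetoid n) (ℤⁿ-decSetoid n) U rbox h rexp⁻¹ rexp
                                       (qBox-unique e m) (boxℤ-unique (bound f) (λ k → rexp a k ℤ.- bound g))
                                       h-resp rexp⁻¹-cong rexp-cong
                                       rexp⁻¹-rexp rexp-rexp⁻¹ outside-rbox outside-U ⟩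
      ∑ rbox (h ∘ rexp⁻¹)         ≈⟨ ∑-cong rbox (λ b → sym (product-term-in-q f-supp g-supp a b)) ⟩
      coeff (mulLS f g) (rexp a)  ∎)
      where
      h : (Fin n → ℤ) → K
      h a' = F a' * G (a ⊖ a')
      rbox : List (Fin n → ℤ)
      rbox = boxℤ (bound f) (λ k → rexp a k ℤ.- bound g)
      h-resp : ∀ {a' a''} → a' ≗ a'' → h a' ≈ h a''
      h-resp a'≗a'' = *-cong (qCoeff-resp f-supp a'≗a'')
                             (qCoeff-resp g-supp (λ k → ≡.cong (λ x → a k ℤ.- x) (a'≗a'' k)))
      outside-rbox : ∀ a' → a' ∈ U → ¬ Any (rexp a' ≗_) rbox → h a' ≈ 0#
      outside-rbox a' _ ∉rbox with ∉-boxℤ (bound f) _ (rexp a') ∉rbox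
      ... | k , inj₁ below-f = *-zeroˡ-≈ (coeff-below f-supp (rexp a') k below-f)
      ... | k , inj₂ above   = *-zeroʳ-≈ (coeff-below g-supp (rexp (a ⊖ a')) k
          (≡.subst (ℤ._< bound g) (≡.sym (rexp-⊖ a a' k)) (swap-< (rexp a k) (rexp a' k) (bound g) above)))
        where
        swap-< : ∀ x y z → x ℤ.- z ℤ.< y → x ℤ.- y ℤ.< z
        swap-< x y z x-z<y = ≡.subst₂ ℤ._<_ (lhs x y z) (i+[j-i]≡j y z) (ℤP.+-monoˡ-< (z ℤ.- y) x-z<y)
          where
          lhs : ∀ x y z → x ℤ.- z ℤ.+ (z ℤ.- y) ≡ x ℤ.- y
          lhs = solve-∀
      outside-U : ∀ b → b ∈ rbox → ¬ Any (rexp⁻¹ b ≗_) U → h (rexp⁻¹ b) ≈ 0#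
      outside-U b _ = summand-outside-U a (rexp⁻¹ b) t

    shift : ∀ a' → ∑ U (λ a → [ matches e m a ] (F a' * G (a ⊖ a'))) ≈
                   ∑ U (λ a'' → [ matches e m (a' ⊕ a'') ] (F a' * G a''))
    shift a' = trans (∑-reindex-bijection (ℤⁿ-decSetoid n) (ℤⁿ-decSetoid n) U U h (a' ⊕_) (_⊖ a')
                        (qBox-unique e m) (qBox-unique e m) h-resp
                        (λ p k → ≡.cong (λ x → a' k ℤ.+ x) (p k)) (λ p k → ≡.cong (ℤ._- a' k) (p k))
                        (λ a k → i+[j-i]≡j (a' k) (a k)) (λ a'' k → i+j-i≡j (a' k) (a'' k))
                        outside-U-shifted outside-U)
                     (∑-cong U (λ a'' → []-cong (matches e m (a' ⊕ a'')) λ _ →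
                                          *-congˡ (qCoeff-resp g-supp (λ k → i+j-i≡j (a' k) (a'' k)))))
      where
      h : (Fin n → ℤ) → K
      h a = [ matches e m a ] (F a' * G (a ⊖ a'))
      h-resp : ∀ {a b} → a ≗ b → h a ≈ h b
      h-resp a≗b = []-cong-≡ (matches-cong (λ _ → ≡.refl) ≡.refl a≗b)
                             (*-congˡ (qCoeff-resp g-supp (λ k → ≡.cong (ℤ._- a' k) (a≗b k))))
      outside-U-shifted : ∀ a → a ∈ U → ¬ Any ((a ⊖ a') ≗_) U → h a ≈ 0#
      outside-U-shifted a _ ∉U = []-vanish (matches e m a) λ t → remainder-outside-U a a' t ∉U
      outside-U : ∀ a'' → a'' ∈ U → ¬ Any ((a' ⊕ a'') ≗_) U → h (a' ⊕ a'') ≈ 0#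
      outside-U a'' _ ∉U = []-vanish (matches e m (a' ⊕ a'')) λ t →
        contradiction (∈-qBox⁺-self (to (T-matches e m (a' ⊕ a'')) t)) ∉U

    split-term : (Fin n → ℕ) → ℕ → (Fin n → ℤ) → (Fin n → ℤ) → K
    split-term e' m' a' a'' = ([ matches e' m' a' ] F a') * ([ matches (λ k → e k ∸ e' k) (m ∸ m') a'' ] G a'')

    mulPS-B-expand : mulPS (B f) (B g) e m ≈
      ∑ U (λ a' → ∑ U (λ a'' → ∑ (boxℕ e) (λ e' → ∑ (upTo (suc m)) (λ m' → split-term e' m' a' a''))))
    mulPS-B-expand = begin
      mulPS (B f) (B g) e m
        ≈⟨ ∑-cong-∈ (boxℕ e) (λ e' e'∈ → ∑-cong-∈ (upTo (suc m)) (λ m' m'∈ →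
             trans (*-cong (B-wider f (coeff-resp f-supp) (∈-boxℕ⁻ e e'∈) (ℕP.≤-pred (∈-upTo⁻ m'∈)))
                           (B-wider g (coeff-resp g-supp) {e = e} {m = m}
                                    (λ k → ℕP.m∸n≤m (e k) (e' k)) (ℕP.m∸n≤m m m')))
                   (∑-*-∑ U U _ _))) ⟩
      ∑ (boxℕ e) (λ e' → ∑ (upTo (suc m)) (λ m' → ∑ U (λ a' → ∑ U (split-term e' m' a'))))
        ≈⟨ ∑-cong (boxℕ e) (λ e' → ∑-comm (upTo (suc m)) U _) ⟩
      ∑ (boxℕ e) (λ e' → ∑ U (λ a' → ∑ (upTo (suc m)) (λ m' → ∑ U (split-term e' m' a'))))
        ≈⟨ ∑-cong (boxℕ e) (λ e' → ∑-cong U (λ a' → ∑-comm (upTo (suc m)) U _)) ⟩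
      ∑ (boxℕ e) (λ e' → ∑ U (λ a' → ∑ U (λ a'' → ∑ (upTo (suc m)) (λ m' → split-term e' m' a' a''))))
        ≈⟨ ∑-comm (boxℕ e) U _ ⟩
      ∑ U (λ a' → ∑ (boxℕ e) (λ e' → ∑ U (λ a'' → ∑ (upTo (suc m)) (λ m' → split-term e' m' a' a''))))
        ≈⟨ ∑-cong U (λ a' → ∑-comm (boxℕ e) U _) ⟩
      ∑ U (λ a' → ∑ U (λ a'' → ∑ (boxℕ e) (λ e' → ∑ (upTo (suc m)) (λ m' → split-term e' m' a' a'')))) ∎

    ∑-split-terms : (Fin n → ℤ) → (Fin n → ℤ) → K
    ∑-split-terms a' a'' = ∑ (boxℕ e) (λ e' → ∑ (upTo (suc m)) (λ m' → split-term e' m' a' a''))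

    -- Inside the orthant q^{a'} q^{a''} is split uniquely: e' must be posPart a' and m' must be negMass a'.
    module _ {a' a'' : Fin n → ℤ} (a'∈ : InOrthant σ a') (a''∈ : InOrthant σ a'') where
      open DecSetoid (ℕⁿ-decSetoid n) using () renaming (_≟_ to _≟ⁿ_)

      rest : K
      rest = F a' * ([ matches (λ k → e k ∸ posPart a' k) (m ∸ negMass a') a'' ] G a'')

      split-term-δ : ∀ e' m' → split-term e' m' a' a'' ≈ [ does (e' ≟ⁿ posPart a') ] ([ does (m' ℕ.≟ negMass a') ] rest)
      split-term-δ e' m' = δ-form (e' ≟ⁿ posPart a') (m' ℕ.≟ negMass a')
        where
        δ-form : (d₁ : Dec (e' ≗ posPart a')) (d₂ : Dec (m' ≡ negMass a')) →
                 split-term e' m' a' a'' ≈ [ does d₁ ] ([ does d₂ ] rest)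
        δ-form (yes e'≗) (yes m'≡) =
          *-cong ([]-true (from (T-matches e' m' a') ((≡.sym ∘ e'≗) , ≡.sym m'≡)))
                 ([]-cong-≡ (matches-cong {a = a''} (λ k → ≡.cong (e k ∸_) (e'≗ k)) (≡.cong (m ∸_) m'≡) (λ _ → ≡.refl))
                            refl)
        δ-form (yes _)   (no m'≢) = *-zeroˡ-≈ ([]-false λ t → m'≢ (≡.sym (proj₂ (to (T-matches e' m' a') t))))
        δ-form (no e'≉)  _        = *-zeroˡ-≈ ([]-false λ t → e'≉ (≡.sym ∘ proj₁ (to (T-matches e' m' a') t)))

      rest-fits : (∀ k → posPart a' k ℕ.≤ e k) → negMass a' ℕ.≤ m → rest ≈ [ matches e m (a' ⊕ a'') ] (F a' * G a'')
      rest-fits pos≤e mass≤m = trans (sym ([]-*ˡ _ (F a') (G a''))) ([]-cong-≡ same-test refl)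
        where
        same-test : matches (λ k → e k ∸ posPart a' k) (m ∸ negMass a') a'' ≡ matches e m (a' ⊕ a'')
        same-test = T-injective (mk⇔
          (λ t → from (T-matches e m (a' ⊕ a'')) (Matches-⊕⁺ σ a'∈ a''∈ pos≤e mass≤m (to (T-matches _ _ a'') t)))
          (λ t → from (T-matches _ _ a'') (proj₂ (proj₂ (Matches-⊕⁻ σ a'∈ a''∈ (to (T-matches e m (a' ⊕ a'')) t))))))

      δ-collapse : ∑ (boxℕ e) (λ e' → [ does (e' ≟ⁿ posPart a') ]
                   ∑ (upTo (suc m)) (λ m' → [ does (m' ℕ.≟ negMass a') ] rest))
                 ≈ [ matches e m (a' ⊕ a'') ] (F a' * G a'')
      δ-collapse with negMass a' ℕP.≤? m | FinP.all? (λ k → posPart a' k ℕP.≤? e k)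
      ... | no mass≰m | _ =
        trans (∑-zero (boxℕ e) (λ e' _ → []-zero (does (e' ≟ⁿ posPart a'))
                 (∑-δ-∉ ℕP.≡-decSetoid (upTo (suc m)) (negMass a') rest (mass≰m ∘ ℕP.≤-pred ∘ ∈-upTo⁻))))
              (sym ([]-false λ t → mass≰m (proj₁ (proj₂ (Matches-⊕⁻ σ a'∈ a''∈ (to (T-matches e m (a' ⊕ a'')) t))))))
      ... | yes mass≤m | no pos≰e =
        trans (∑-δ-∉ (ℕⁿ-decSetoid n) (boxℕ e) (posPart a') _ pos∉box)
              (sym ([]-false λ t → pos≰e (proj₁ (Matches-⊕⁻ σ a'∈ a''∈ (to (T-matches e m (a' ⊕ a'')) t)))))
        where
        pos∉box : ¬ Any (posPart a' ≗_) (boxℕ e)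
        pos∉box pos∈ = let x , x∈ , pos≗x = find pos∈ in
                       pos≰e (λ k → ≡.subst (ℕ._≤ e k) (≡.sym (pos≗x k)) (∈-boxℕ⁻ e x∈ k))
      ... | yes mass≤m | yes pos≤e =
        trans (∑-cong (boxℕ e) (λ e' → []-cong (does (e' ≟ⁿ posPart a')) λ _ →
                 ∑-δ-∈ ℕP.≡-decSetoid (upTo (suc m)) (negMass a') rest (UniqueP.upTo⁺ _) (∈-upTo⁺ (ℕ.s≤s mass≤m))))
        (trans (∑-δ-∈ (ℕⁿ-decSetoid n) (boxℕ e) (posPart a') rest (boxℕ-unique e) (∈-boxℕ⁺ e _ pos≤e))
               (rest-fits pos≤e mass≤m))

      split-collapse-inOrthant : ∑-split-terms a' a'' ≈ [ matches e m (a' ⊕ a'') ] (F a' * G a'')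
      split-collapse-inOrthant = begin
        ∑-split-terms a' a''
          ≈⟨ ∑-cong (boxℕ e) (λ e' → trans (∑-cong (upTo (suc m)) (split-term-δ e')) (sym ([]-∑ _ (upTo (suc m)) _))) ⟩
        ∑ (boxℕ e) (λ e' → [ does (e' ≟ⁿ posPart a') ]
          ∑ (upTo (suc m)) (λ m' → [ does (m' ℕ.≟ negMass a') ] rest))
          ≈⟨ δ-collapse ⟩
        [ matches e m (a' ⊕ a'') ] (F a' * G a'') ∎

    private
      both-vanish : ∀ {a' a''} → (∀ e' m' → split-term e' m' a' a'' ≈ 0#) → F a' * G a'' ≈ 0# →
                    ∑-split-terms a' a'' ≈ [ matches e m (a' ⊕ a'') ] (F a' * G a'')
      both-vanish {a'} {a''} terms≈0 FG≈0 =
        trans (∑-zero (boxℕ e) (λ e' _ → ∑-zero (upTo (suc m)) (λ m' _ → terms≈0 e' m')))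
              (sym ([]-zero (matches e m (a' ⊕ a'')) FG≈0))

    split-collapse : ∀ a' a'' → ∑-split-terms a' a'' ≈ [ matches e m (a' ⊕ a'') ] (F a' * G a'')
    split-collapse a' a'' with inOrthant? σ a' | inOrthant? σ a''
    ... | yes a'∈ | yes a''∈ = split-collapse-inOrthant a'∈ a''∈
    ... | no a'∉  | _        = let F≈0 = coeff-outside f-supp a' a'∉ in
      both-vanish (λ e' m' → *-zeroˡ-≈ ([]-zero (matches e' m' a') F≈0)) (*-zeroˡ-≈ F≈0)
    ... | yes _   | no a''∉  = let G≈0 = coeff-outside g-supp a'' a''∉ in
      both-vanish (λ e' m' → *-zeroʳ-≈ ([]-zero (matches _ _ a'') G≈0)) (*-zeroʳ-≈ G≈0)

    B-mulLS-at : B (mulLS f g) e m ≈ mulPS (B f) (B g) e m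
    B-mulLS-at = begin
      B (mulLS f g) e m
        ≈⟨ ∑-cong U (λ a → []-cong (matches e m a) (coeff-mulLS-in-q a)) ⟩
      ∑ U (λ a → [ matches e m a ] ∑ U (λ a' → F a' * G (a ⊖ a')))
        ≈⟨ ∑-cong U (λ a → []-∑ (matches e m a) U _) ⟩
      ∑ U (λ a → ∑ U (λ a' → [ matches e m a ] (F a' * G (a ⊖ a'))))
        ≈⟨ ∑-comm U U _ ⟩
      ∑ U (λ a' → ∑ U (λ a → [ matches e m a ] (F a' * G (a ⊖ a'))))
        ≈⟨ ∑-cong U shift ⟩
      ∑ U (λ a' → ∑ U (λ a'' → [ matches e m (a' ⊕ a'') ] (F a' * G a'')))
        ≈⟨ ∑-cong U (λ a' → ∑-cong U (λ a'' → sym (split-collapse a' a''))) ⟩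
      ∑ U (λ a' → ∑ U (λ a'' → ∑-split-terms a' a''))
        ≈⟨ sym mulPS-B-expand ⟩
      mulPS (B f) (B g) e m ∎

  B-mulLS : ∀ {n} {σ : Fin n → Bool} {f g : LS n} → Supported σ f → Supported σ g → B (mulLS f g) ≈PS mulPS (B f) (B g)
  B-mulLS f-supp g-supp = Multiplicativity.B-mulLS-at f-supp g-supp

  B-Ax : ∀ {n} {σ : Fin n → Bool} β α (x : Var n) → σ (Var.i x) ≡ true → σ (Var.j x) ≡ false →
         B (Ax β α x) ≈PS Et β α (Var.i x)
  B-Ax {n} β α (var i j i<j) σi σj = begin
    B (negLS (mulLS (numeratorLS β α i j) (geomLS i j)))
      ≈⟨ B-negLS (mulLS (numeratorLS β α i j) (geomLS i j)) ⟩
    negPS (B (mulLS (numeratorLS β α i j) (geomLS i j)))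
      ≈⟨ negPS-cong (B-mulLS (Supported-numeratorLS β α σi σj) (Supported-geomLS i<j σi σj)) ⟩
    negPS (mulPS (B (numeratorLS β α i j)) (B (geomLS i j)))
      ≈⟨ negPS-cong (mulPS-cong (B-numeratorLS β α i j) (B-geomLS i<j)) ⟩
    Et β α i ∎
    where open SetoidReasoning (PS-setoid {n})

  RespPS : ∀ {n} → PS n → Set ℓ
  RespPS f = ∀ {e e'} m → e ≗ e' → f e m ≈ f e' m

  module _ {n : ℕ} where

    monoPS-resp : ∀ e₀ m₀ x → RespPS (monoPS {n} e₀ m₀ x)
    monoPS-resp e₀ m₀ x m e≗e' = []-cong-≡ (≡.cong (_∧ (m ℕ.≡ᵇ m₀)) (eqVecℕ-cong e≗e' (λ _ → ≡.refl))) refl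

    geomPS-resp : ∀ i → RespPS (geomPS {n} i)
    geomPS-resp i m e≗e' = []-cong-≡ (eqVecℕ-cong e≗e' (λ _ → ≡.refl)) refl

    addPS-resp : ∀ {f g : PS n} → RespPS f → RespPS g → RespPS (addPS f g)
    addPS-resp f-resp g-resp m e≗e' = +-cong (f-resp m e≗e') (g-resp m e≗e')

    negPS-resp : ∀ {f : PS n} → RespPS f → RespPS (negPS f)
    negPS-resp f-resp m e≗e' = -‿cong (f-resp m e≗e')

    scalePS-resp : ∀ x {f : PS n} → RespPS f → RespPS (scalePS x f)
    scalePS-resp x f-resp m e≗e' = *-congˡ (f-resp m e≗e')

    mulPS-resp : ∀ (f : PS n) {g} → RespPS g → RespPS (mulPS f g)
    mulPS-resp f {g} g-resp {e} {e'} m e≗e' =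
      ≡.subst (λ L → ∑ L (term e) ≈ ∑ (boxℕ e') (term e')) (≡.sym (boxℕ-cong e≗e'))
              (∑-cong (boxℕ e') (λ x → ∑-cong (upTo (suc m)) (λ m' →
                 *-congˡ (g-resp (m ∸ m') (λ k → ≡.cong (_∸ x k) (e≗e' k))))))
      where
      term : (Fin n → ℕ) → (Fin n → ℕ) → K
      term e x = ∑ (upTo (suc m)) (λ m' → f x m' * g (λ k → e k ∸ x k) (m ∸ m'))

    Et-resp : ∀ β α (i : Fin n) → RespPS (Et β α i)
    Et-resp β α i = negPS-resp (mulPS-resp _ (geomPS-resp i))

    prodPS-Et-resp : ∀ β α (is : List (Fin n)) → RespPS (prodPS (map (Et β α) is))
    prodPS-Et-resp β α []       = monoPS-resp _ _ _
    prodPS-Et-resp β α (i ∷ is) = mulPS-resp _ (prodPS-Et-resp β α is)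

  module _ {n : ℕ} where

    embed-addPS : ∀ (f g : PS n) → embed (addPS f g) ≈PS addPS (embed f) (embed g)
    embed-addPS f g e m = []-+ (last e ℕ.≡ᵇ 0) _ _

    embed-negPS : ∀ (f : PS n) → embed (negPS f) ≈PS negPS (embed f)
    embed-negPS f e m = []-neg (last e ℕ.≡ᵇ 0) _

    embed-scalePS : ∀ x (f : PS n) → embed (scalePS x f) ≈PS scalePS x (embed f)
    embed-scalePS x f e m = []-*ˡ (last e ℕ.≡ᵇ 0) x _

    embed-zeroPS : embed (zeroPS {n}) ≈PS zeroPS
    embed-zeroPS e m = []-zero (last e ℕ.≡ᵇ 0) refl

    embed-monoPS : ∀ (e₀ : Fin n → ℕ) e₁ m₀ x → init e₁ ≗ e₀ → last e₁ ≡ 0 → embed (monoPS e₀ m₀ x) ≈PS monoPS e₁ m₀ x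
    embed-monoPS e₀ e₁ m₀ x init≗ last≡0 e m = trans ([]-∧ (last e ℕ.≡ᵇ 0) _ x)
      ([]-cong-≡ (≡.trans (≡.sym (∧-assoc (last e ℕ.≡ᵇ 0) _ (m ℕ.≡ᵇ m₀)))
                          (≡.cong (_∧ (m ℕ.≡ᵇ m₀)) (embed-test e e₀ {e₁} init≗ last≡0))) refl)

    embed-geomPS : ∀ (i : Fin n) → embed (geomPS i) ≈PS geomPS (inject₁ i)
    embed-geomPS i e m = trans ([]-∧ (last e ℕ.≡ᵇ 0) _ 1#)
      ([]-cong-≡ (embed-test e (λ k → m ℕ.* unitℕ i k) {λ k → m ℕ.* unitℕ (inject₁ i) k}
                             (λ k → ≡.cong (m ℕ.*_) (unitℕ-inject₁ i k))
                             (≡.trans (≡.cong (m ℕ.*_) (unitℕ-inject₁-last i)) (ℕP.*-zeroʳ m)))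
                 refl)

    ∑-boxℕ-init : ∀ (e : Fin (suc n) → ℕ) (h : (Fin n → ℕ) → K) → (∀ {x x'} → x ≗ x' → h x ≈ h x') →
                  last e ≡ 0 → ∑ (boxℕ (init e)) h ≈ ∑ (boxℕ e) (h ∘ init)
    ∑-boxℕ-init e h h-resp last≡0 =
      ∑-reindex (ℕⁿ-decSetoid n) (ℕⁿ-decSetoid (suc n)) (boxℕ (init e)) (boxℕ e) h init padZero
                (boxℕ-unique (init e)) (boxℕ-unique e) outside-M outside-L agree
      where
      open DecSetoid (ℕⁿ-decSetoid n) using () renaming (_≟_ to _≟ⁿ_)
      open DecSetoid (ℕⁿ-decSetoid (suc n)) using () renaming (_≟_ to _≟ⁿ⁺¹_)
      outside-M : ∀ x → x ∈ boxℕ (init e) → ¬ Any (padZero x ≗_) (boxℕ e) → h x ≈ 0#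
      outside-M x x∈ ∉ = contradiction (∈-boxℕ⁺ e (padZero x) padZero≤e) ∉
        where
        padZero≤e : ∀ k → padZero x k ℕ.≤ e k
        padZero≤e k with view k
        ... | ‵fromℕ          = ℕP.≤-trans (ℕP.≤-reflexive (last-padZero x)) ℕ.z≤n
        ... | ‵inj₁ {i = i} _ = ≡.subst (ℕ._≤ e (inject₁ i)) (≡.sym (init-padZero x i)) (∈-boxℕ⁻ (init e) x∈ i)
      outside-L : ∀ y → y ∈ boxℕ e → ¬ Any (init y ≗_) (boxℕ (init e)) → h (init y) ≈ 0#
      outside-L y y∈ ∉ = contradiction (∈-boxℕ⁺ (init e) (init y) (λ k → ∈-boxℕ⁻ e y∈ (inject₁ k))) ∉
      agree : ∀ x y → x ∈ boxℕ (init e) → y ∈ boxℕ e →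
              [ does (y ≟ⁿ⁺¹ padZero x) ] h x ≈ [ does (x ≟ⁿ init y) ] h (init y)
      agree x y _ y∈ = agree′ (y ≟ⁿ⁺¹ padZero x) (x ≟ⁿ init y)
        where
        agree′ : (d₁ : Dec (y ≗ padZero x)) (d₂ : Dec (x ≗ init y)) → [ does d₁ ] h x ≈ [ does d₂ ] h (init y)
        agree′ (yes _)   (yes x≗y) = h-resp x≗y
        agree′ (yes y≗x) (no x≉y)  = contradiction (λ k → ≡.sym (≡.trans (y≗x (inject₁ k)) (init-padZero x k))) x≉y
        agree′ (no y≉x)  (yes x≗y) =
          contradiction (≗-init-last (λ k → ≡.trans (≡.sym (x≗y k)) (≡.sym (init-padZero x k)))
                                     (≡.trans (∈-boxℕ-last {e = e} last≡0 y∈) (≡.sym (last-padZero x)))) y≉x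
        agree′ (no _)    (no _)    = refl

    -- Both sides vanish unless t_n does not occur; then mulPS (embed f) (embed g) only sees splittings with
    -- no t_n on either side, which are the padded splittings of mulPS f g.
    embed-mulPS : ∀ (f g : PS n) → RespPS f → RespPS g → embed (mulPS f g) ≈PS mulPS (embed f) (embed g)
    embed-mulPS f g f-resp g-resp e m with T? (last e ℕ.≡ᵇ 0)
    ... | no last≢0 =
      trans ([]-false last≢0) (sym (∑-zero (boxℕ e) (λ ê _ → ∑-zero (upTo (suc m)) (λ m' _ → term≈0 ê m'))))
      where
      term≈0 : ∀ ê m' → embed f ê m' * embed g (λ k → e k ∸ ê k) (m ∸ m') ≈ 0#
      term≈0 ê m' with T? (last ê ℕ.≡ᵇ 0)
      ... | no  ¬t = *-zeroˡ-≈ ([]-false ¬t)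
      ... | yes t  = *-zeroʳ-≈ ([]-false {last e ∸ last ê ℕ.≡ᵇ 0} λ t' →
                       last≢0 (≡.subst (λ z → T ((last e ∸ z) ℕ.≡ᵇ 0)) (ℕP.≡ᵇ⇒≡ (last ê) 0 t) t'))
    ... | yes last≡ᵇ0 =
      trans ([]-true last≡ᵇ0) (trans (∑-boxℕ-init e h h-resp last≡0) (∑-cong-∈ (boxℕ e) both-embedded))
      where
      last≡0 : last e ≡ 0
      last≡0 = ℕP.≡ᵇ⇒≡ _ 0 last≡ᵇ0
      h : (Fin n → ℕ) → K
      h x = ∑ (upTo (suc m)) (λ m' → f x m' * g (λ k → init e k ∸ x k) (m ∸ m'))
      h-resp : ∀ {x x'} → x ≗ x' → h x ≈ h x'
      h-resp x≗x' = ∑-cong (upTo (suc m)) (λ m' →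
        *-cong (f-resp m' x≗x') (g-resp (m ∸ m') (λ k → ≡.cong (init e k ∸_) (x≗x' k))))
      both-embedded : ∀ ê → ê ∈ boxℕ e →
                      h (init ê) ≈ ∑ (upTo (suc m)) (λ m' → embed f ê m' * embed g (λ k → e k ∸ ê k) (m ∸ m'))
      both-embedded ê ê∈ = ∑-cong (upTo (suc m)) (λ m' →
        sym (*-cong ([]-true (ℕP.≡⇒≡ᵇ _ 0 last-ê≡0)) ([]-true (ℕP.≡⇒≡ᵇ _ 0 (≡.cong₂ _∸_ last≡0 last-ê≡0)))))
        where
        last-ê≡0 : last ê ≡ 0
        last-ê≡0 = ∈-boxℕ-last {e = e} last≡0 ê∈

  module _ (β α : K) where

    embed-numeratorPS : ∀ {n} (i : Fin n) → embed (numeratorPS β α i) ≈PS numeratorPS β α (inject₁ i)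
    embed-numeratorPS {n} i = begin
      embed (addPS (addPS (tPS i) (constPS β)) (scalePS α wPS))
        ≈⟨ embed-addPS (addPS (tPS i) (constPS β)) (scalePS α wPS) ⟩
      addPS (embed (addPS (tPS i) (constPS β))) (embed (scalePS α wPS))
        ≈⟨ addPS-cong (embed-addPS (tPS i) (constPS β)) (embed-scalePS α wPS) ⟩
      addPS (addPS (embed (tPS i)) (embed (constPS β))) (scalePS α (embed wPS))
        ≈⟨ addPS-cong (addPS-cong (embed-monoPS (unitℕ i) (unitℕ (inject₁ i)) 0 1#
                                                (unitℕ-inject₁ i) (unitℕ-inject₁-last i))
                                  (embed-monoPS (λ _ → 0) (λ _ → 0) 0 β (λ _ → ≡.refl) ≡.refl))
                      (scalePS-cong α (embed-monoPS (λ _ → 0) (λ _ → 0) 1 1# (λ _ → ≡.refl) ≡.refl)) ⟩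
      addPS (addPS (tPS (inject₁ i)) (constPS β)) (scalePS α wPS) ∎
      where open SetoidReasoning (PS-setoid {suc n})

    embed-Et : ∀ {n} (i : Fin n) → embed (Et β α i) ≈PS Et β α (inject₁ i)
    embed-Et {n} i = begin
      embed (negPS (mulPS (numeratorPS β α i) (geomPS i)))
        ≈⟨ embed-negPS (mulPS (numeratorPS β α i) (geomPS i)) ⟩
      negPS (embed (mulPS (numeratorPS β α i) (geomPS i)))
        ≈⟨ negPS-cong (embed-mulPS (numeratorPS β α i) (geomPS i) numerator-resp (geomPS-resp i)) ⟩
      negPS (mulPS (embed (numeratorPS β α i)) (embed (geomPS i)))
        ≈⟨ negPS-cong (mulPS-cong (embed-numeratorPS i) (embed-geomPS i)) ⟩
      Et β α (inject₁ i) ∎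
      where
      open SetoidReasoning (PS-setoid {suc n})
      numerator-resp : RespPS (numeratorPS β α i)
      numerator-resp = addPS-resp (addPS-resp (monoPS-resp _ _ _) (monoPS-resp _ _ _))
                                  (scalePS-resp α (monoPS-resp _ _ _))

    inject₁-lowerVar : ∀ {n} (x : Var (suc n)) → inject₁ (lowerVar x) ≡ Var.i x
    inject₁-lowerVar (var i j i<j) = FinP.toℕ-injective (≡.trans (FinP.toℕ-inject₁ _) (FinP.toℕ-fromℕ< _))

    embed-E-monomial : ∀ {n} (mo : Monomial (suc n)) →
      embed (prodPS (map (Et β α) (map lowerVar mo))) ≈PS prodPS (map (Et β α ∘ Var.i) mo)
    embed-E-monomial []       = embed-monoPS (λ _ → 0) (λ _ → 0) 0 1# (λ _ → ≡.refl) ≡.refl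
    embed-E-monomial (x ∷ mo) = λ e m → trans
      (embed-mulPS _ _ (Et-resp β α (lowerVar x)) (prodPS-Et-resp β α (map lowerVar mo)) e m)
      (mulPS-cong embed-Et-lowerVar (embed-E-monomial mo) e m)
      where
      embed-Et-lowerVar : embed (Et β α (lowerVar x)) ≈PS Et β α (Var.i x)
      embed-Et-lowerVar =
        ≡.subst (λ i → embed (Et β α (lowerVar x)) ≈PS Et β α i) (inject₁-lowerVar x) (embed-Et (lowerVar x))

    module _ {n} (σ : Fin n → Bool) where

      SignedBy : Monomial n → Set
      SignedBy mo = ∀ {x} → x ∈ mo → σ (Var.i x) ≡ true × σ (Var.j x) ≡ false

      Supported-A-monomial : ∀ mo → SignedBy mo → Supported σ (prodLS (map (Ax β α) mo))
      Supported-A-monomial []       _      = Supported-constLS 1#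
      Supported-A-monomial (x ∷ mo) signed =
        Supported-mulLS (Supported-Ax {σ = σ} β α x (proj₁ (signed (here ≡.refl))) (proj₂ (signed (here ≡.refl))))
                        (Supported-A-monomial mo (signed ∘ there))

      B-A-monomial : ∀ mo → SignedBy mo → B (prodLS (map (Ax β α) mo)) ≈PS prodPS (map (Et β α ∘ Var.i) mo)
      B-A-monomial []       _      = B-monoLS 1# (≡.sym ∘ rexp-1ᵉ) Matches-1ᵉ
      B-A-monomial (x ∷ mo) signed = λ e m → trans
        (B-mulLS (Supported-Ax {σ = σ} β α x σi σj) (Supported-A-monomial mo (signed ∘ there)) e m)
        (mulPS-cong (B-Ax {σ = σ} β α x σi σj) (B-A-monomial mo (signed ∘ there)) e m)
        where
        σi : σ (Var.i x) ≡ true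
        σi = proj₁ (signed (here ≡.refl))
        σj : σ (Var.j x) ≡ false
        σj = proj₂ (signed (here ≡.refl))

    -- Mark the sources i of the variables x_{i,j} as positive; for a pathless monomial no target is a source.
    sources : ∀ {n} → Monomial n → Fin n → Bool
    sources mo k = does (any? (λ x → Var.i x Fin.≟ k) mo)

    SignedBy-sources : ∀ {n} (mo : Monomial n) → PathlessMono mo → SignedBy (sources mo) mo
    SignedBy-sources mo pathless {x} x∈ =
      dec-true (any? (λ y → Var.i y Fin.≟ Var.i x) mo) (Any.map (λ { ≡.refl → ≡.refl }) x∈) ,
      dec-false (any? (λ y → Var.i y Fin.≟ Var.j x) mo)
                (λ j-is-source → let y , y∈ , yi≡xj = find j-is-source in pathless x∈ y∈ (≡.sym yi≡xj))

    embed∘E∘D≈B∘A : ∀ {n} (q : Poly (suc n)) → PathlessPoly q → embed (E β α (D q)) ≈PS B (A β α q)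
    embed∘E∘D≈B∘A []               _                  = λ e m → trans (embed-zeroPS e m) (sym (B-zeroLS e m))
    embed∘E∘D≈B∘A {n} ((a , mo) ∷ q) (pathless ∷ pathless-q) = begin
      embed (addPS (scalePS a E-mo) (E β α (D q)))
        ≈⟨ embed-addPS (scalePS a E-mo) (E β α (D q)) ⟩
      addPS (embed (scalePS a E-mo)) (embed (E β α (D q)))
        ≈⟨ addPS-cong (embed-scalePS a E-mo) (embed∘E∘D≈B∘A q pathless-q) ⟩
      addPS (scalePS a (embed E-mo)) (B (A β α q))
        ≈⟨ addPS-cong (scalePS-cong a (embed-E-monomial mo)) (λ _ _ → refl) ⟩
      addPS (scalePS a (prodPS (map (Et β α ∘ Var.i) mo))) (B (A β α q))
        ≈˘⟨ addPS-cong (scalePS-cong a (B-A-monomial (sources mo) mo (SignedBy-sources mo pathless))) (λ _ _ → refl) ⟩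
      addPS (scalePS a (B A-mo)) (B (A β α q))
        ≈˘⟨ addPS-cong (B-scaleLS a A-mo) (λ _ _ → refl) ⟩
      addPS (B (scaleLS a A-mo)) (B (A β α q))
        ≈˘⟨ B-addLS (scaleLS a A-mo) (A β α q) ⟩
      B (A β α ((a , mo) ∷ q)) ∎
      where
      open SetoidReasoning (PS-setoid {suc n})
      E-mo : PS n
      E-mo = prodPS (map (Et β α) (map lowerVar mo))
      A-mo : LS (suc n)
      A-mo = prodLS (map (Ax β α) mo)

corollary3p17 : ∀ {c ℓ} (R : CommutativeRing c ℓ)
                  (β α : CommutativeRing.Carrier R) (n' : ℕ)
                  (q : Series.Poly R (suc n')) →
                  Series.PathlessPoly R q →
                  Series._≈PS_ R (Series.embed R (Series.E R β α (Series.D R q)))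
                                 (Series.B R (Series.A R β α q))
corollary3p17 R β α n' q pathless = embed∘E∘D≈B∘A R β α q pathless
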